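{- Let $m,n\geq 1$ be integers and let $k$ be an integer with $1\leq k\leq n$. Then $$\sum_{l_{1},\dots,l_{m-1}=0}^{n}\left\vert S_{1}(n,l_{1})S_{1}(l_{1},l_{2})\cdots S_{1}(l_{m-1},k)\right\vert =\sum_{\substack{k_{1}+\cdots+k_{m}=n-k\\ k_1,\dots,k_m\geq 0}}(-1)^{k_{1}+\cdots+k_{m}}\binom{n-1}{k_{1},\dots,k_{m},k-1}\prod_{i=1}^{m}B^{(n-k_{m}-k_{m-1}-\cdots-k_{i+1})}_{k_{i}},$$ i.e. the product on the right is $B^{(n)}_{k_{m}}B^{(n-k_{m})}_{k_{m-1}}\cdots B^{(n-k_{m}-\cdots-k_{2})}_{k_1}$.
   Context: $S_1(n,k)$ denotes the Stirling numbers of the first kind, defined by $(x)_n=x(x-1)\cdots(x-n+1)=\sum_{k=0}^{n}S_1(n,k)x^k$, with $S_1(i,j)=0$ for $j>i$. For $m=1$ the left-hand side has no summation indices and is to be read as $|S_1(n,k)|$. For $\alpha\in\mathbb{R}$, the Bernoulli numbers of order $\alpha$ are $B^{(\alpha)}_n=B^{(\alpha)}_n(0)$, where $\left(\frac{t}{e^t-1}\right)^{\alpha}e^{xt}=\sum_{n\geq 0}B^{(\alpha)}_n(x)\frac{t^n}{n!}$. The multinomial coefficient is $\binom{n-1}{k_1,\dots,k_m,k-1}=\frac{(n-1)!}{k_1!\cdots k_m!\,(k-1)!}$. -}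

module Defs where

open import Data.Nat as ℕ using (ℕ; zero; suc; _∸_; _!)
open import Data.Nat.Properties using (_!≢0; m*n≢0)
open import Data.Integer as ℤ using (ℤ; +_)
open import Data.Rational as ℚ using (ℚ; _/_)
open import Data.List using (List; []; _∷_; map; foldr; upTo; concatMap; filter; length)
open import Relation.Binary.PropositionalEquality using (_≡_)

-- Stirling numbers of the first kind (signed), via the falling factorial
-- (x)_n = x(x-1)...(x-n+1) = Σ_k S1(n,k) x^k.
-- fallingCoeff n j is the coefficient of x^j in (x)_n; the clauses below
-- are exactly polynomial multiplication (x)_{n+1} = (x)_n · (x - n).

fallingCoeff : ℕ → ℕ → ℤ
fallingCoeff zero zero = + 1
fallingCoeff zero (suc j) = + 0
fallingCoeff (suc n) zero = ℤ.- ((+ n) ℤ.* fallingCoeff n zero)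
fallingCoeff (suc n) (suc j) = fallingCoeff n j ℤ.- ((+ n) ℤ.* fallingCoeff n (suc j))

S1 : ℕ → ℕ → ℤ
S1 = fallingCoeff

sumℚ : List ℚ → ℚ
sumℚ = foldr ℚ._+_ ℚ.0ℚ

prodℚ : List ℚ → ℚ
prodℚ = foldr ℚ._*_ ℚ.1ℚ

PS : Set
PS = ℕ → ℚ

_⊛_ : PS → PS → PS
(a ⊛ b) n = sumℚ (map (λ i → a i ℚ.* b (n ∸ i)) (upTo (suc n)))

onePS : PS
onePS zero = ℚ.1ℚ
onePS (suc _) = ℚ.0ℚ

_^PS_ : PS → ℕ → PS
a ^PS zero = onePS
a ^PS suc α = a ⊛ (a ^PS α)

-- Multiplicative inverse of a power series with constant term 1:
-- g_0 = 1, g_n = - Σ_{j=1}^{n} f_j g_{n-j}.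
-- invRev f n is the list [g_n, g_{n-1}, ..., g_0].
private
  zipSum : PS → ℕ → List ℚ → ℚ
  zipSum f i [] = ℚ.0ℚ
  zipSum f i (g ∷ gs) = f (suc i) ℚ.* g ℚ.+ zipSum f (suc i) gs

invRev : PS → ℕ → List ℚ
invRev f zero = ℚ.1ℚ ∷ []
invRev f (suc n) = ℚ.- (zipSum f 0 (invRev f n)) ∷ invRev f n

head0 : List ℚ → ℚ
head0 [] = ℚ.0ℚ
head0 (x ∷ _) = x

inv1PS : PS → PS
inv1PS f n = head0 (invRev f n)

expm1OverT : PS
expm1OverT j = (+ 1) / (suc j !) where instance _ = (suc j) !≢0

tOverExpm1 : PS
tOverExpm1 = inv1PS expm1OverT

-- Bernoulli numbers of order α (α ∈ ℕ), B^{(α)}_n = B^{(α)}_n(0):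
-- (t/(e^t-1))^α = Σ_n B^{(α)}_n t^n / n!
B : (α n : ℕ) → ℚ
B α n = ((+ (n !)) / 1) ℚ.* (tOverExpm1 ^PS α) n

tuples : ℕ → ℕ → List (List ℕ)
tuples zero n = [] ∷ []
tuples (suc r) n = concatMap (λ l → map (l ∷_) (tuples r n)) (upTo (suc n))

sumℕ : List ℕ → ℕ
sumℕ = foldr ℕ._+_ 0

compositions : ℕ → ℕ → List (List ℕ)
compositions m s = filter (λ v → sumℕ v ℕ.≟ s) (tuples m s)

chain : ℕ → List ℕ → ℕ → ℤ
chain a [] k = S1 a k
chain a (l ∷ ls) k = S1 a l ℤ.* chain l ls k

LHS : ℕ → ℕ → ℕ → ℕ
LHS m n k = sumℕ (map (λ ls → ℤ.∣ chain n ls k ∣) (tuples (m ∸ 1) n))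

neg1^ : ℕ → ℚ
neg1^ zero = ℚ.1ℚ
neg1^ (suc j) = ℚ.- (neg1^ j)

multinomial : ℕ → List ℕ → ℕ → ℚ
multinomial n ks k =
  (+ ((n ∸ 1) !)) / (foldr ℕ._*_ 1 (map _! ks) ℕ.* (k ∸ 1) !)
  where
  nzProd : (xs : List ℕ) → ℕ.NonZero (foldr ℕ._*_ 1 (map _! xs))
  nzProd [] = ℕ.nonZero
  nzProd (x ∷ xs) = m*n≢0 (x !) _ {{x !≢0}} {{nzProd xs}}
  instance
    _ = m*n≢0 _ ((k ∸ 1) !) {{nzProd ks}} {{(k ∸ 1) !≢0}}

prodB : ℕ → List ℕ → ℚ
prodB n [] = ℚ.1ℚ
prodB n (k₁ ∷ rest) = B (n ∸ sumℕ rest) k₁ ℚ.* prodB n rest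

RHS : ℕ → ℕ → ℕ → ℚ
RHS m n k = sumℚ (map (λ ks → neg1^ (sumℕ ks) ℚ.* multinomial n ks k ℚ.* prodB n ks)
                      (compositions m (n ∸ k)))

{-# OPTIONS --safe #-}
module Submission where

-- Since |S1(i,j)| is the unsigned Stirling number c(i,j), the left side is the (n,k) entry of A^m
-- for the lower triangular matrix A = (c(i,j)). On the right, splitting off l = k_1 leaves the
-- right side for m - 1 at (n, k + l), times (-1)^l C(k+l-1, l) B^(k+l)_l; this factor is c(k+l, k),
-- which is the case m = 1. So both sides are A^m, computed as A·A^(m-1) and as A^(m-1)·A.
-- The case m = 1 comes from the Riccati equation t f′ = f - t f - f² of f = t/(e^t - 1): it gives
-- θ(f^α) = α (f^α - t f^α - f^(α+1)) for θ = t d/dt, and comparing coefficients turns this into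
-- the recurrence c(n+1, i+1) = c(n, i) + n c(n, i+1).

open import Data.Nat as ℕ using (ℕ; zero; suc; _∸_; _!; _<_; _≤_; z≤n; s≤s)
import Data.Nat.Properties as ℕP
open import Data.Nat.Properties using (_!≢0; _!*_!≢0)
import Data.Nat.Solver as ℕSolver
open import Data.Integer as ℤ using (ℤ; +_)
import Data.Integer.Properties as ℤP
import Data.Integer.Solver as ℤSolver
open import Data.Rational as ℚ using (ℚ; _/_; 0ℚ; 1ℚ; toℚᵘ)
import Data.Rational.Properties as ℚP
open import Data.Rational.Unnormalised as ℚᵘ using (mkℚᵘ; *≡*; _≃_)
import Data.Rational.Unnormalised.Properties as ℚᵘP
import Data.Rational.Solver as ℚSolver
open import Data.List using (List; []; _∷_; map; foldr; upTo; applyUpTo; concatMap; concat; filter; _++_)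
open import Data.Empty using (⊥-elim)
open import Relation.Nullary using (Dec; yes; no)
open import Relation.Unary using (Pred; Decidable)
open import Relation.Binary.PropositionalEquality
open import Defs

fromℕ : ℕ → ℚ
fromℕ n = (+ n) / 1

toℚᵘ-fromℕ : ∀ a → toℚᵘ (fromℕ a) ≃ mkℚᵘ (+ a) 0
toℚᵘ-fromℕ a = ℚP.toℚᵘ-fromℚᵘ (mkℚᵘ (+ a) 0)

fromℕ-suc : ∀ a → fromℕ (suc a) ≡ 1ℚ ℚ.+ fromℕ a
fromℕ-suc a = ℚP.toℚᵘ-injective (begin
    toℚᵘ (fromℕ (suc a))
  ≈⟨ toℚᵘ-fromℕ (suc a) ⟩
    mkℚᵘ (+ suc a) 0
  ≈⟨ *≡* (solve 1 (λ x → (con (+ 1) :+ x) :* (con (+ 1) :* con (+ 1)) := (con (+ 1) :* con (+ 1) :+ x :* con (+ 1)) :* con (+ 1)) refl (+ a)) ⟩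
    toℚᵘ 1ℚ ℚᵘ.+ mkℚᵘ (+ a) 0
  ≈⟨ ℚᵘP.+-cong (ℚᵘP.≃-refl {toℚᵘ 1ℚ}) (ℚᵘP.≃-sym (toℚᵘ-fromℕ a)) ⟩
    toℚᵘ 1ℚ ℚᵘ.+ toℚᵘ (fromℕ a)
  ≈⟨ ℚᵘP.≃-sym (ℚP.toℚᵘ-homo-+ 1ℚ (fromℕ a)) ⟩
    toℚᵘ (1ℚ ℚ.+ fromℕ a) ∎)
  where
  open ℚᵘP.≃-Reasoning
  open ℤSolver.+-*-Solver

/-*-cancel : ∀ a d .{{_ : ℕ.NonZero d}} → ((+ a) / d) ℚ.* fromℕ d ≡ fromℕ a
/-*-cancel a d@(suc b) = ℚP.toℚᵘ-injective (begin
    toℚᵘ ((+ a) / d ℚ.* fromℕ d)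
  ≈⟨ ℚP.toℚᵘ-homo-* ((+ a) / d) (fromℕ d) ⟩
    toℚᵘ ((+ a) / d) ℚᵘ.* toℚᵘ (fromℕ d)
  ≈⟨ ℚᵘP.*-cong (ℚP.toℚᵘ-fromℚᵘ (mkℚᵘ (+ a) b)) (toℚᵘ-fromℕ d) ⟩
    mkℚᵘ (+ a) b ℚᵘ.* mkℚᵘ (+ d) 0
  ≈⟨ *≡* (trans (solve 2 (λ x y → (x :* y) :* con (+ 1) := x :* (y :* con (+ 1))) refl (+ a) (+ d)) (cong (+ a ℤ.*_) (sym (ℤP.pos-* d 1)))) ⟩
    mkℚᵘ (+ a) 0
  ≈⟨ ℚᵘP.≃-sym (toℚᵘ-fromℕ a) ⟩
    toℚᵘ (fromℕ a) ∎)
  where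
  open ℚᵘP.≃-Reasoning
  open ℤSolver.+-*-Solver

fromℕ-+ : ∀ a b → fromℕ (a ℕ.+ b) ≡ fromℕ a ℚ.+ fromℕ b
fromℕ-+ zero b = sym (ℚP.+-identityˡ (fromℕ b))
fromℕ-+ (suc a) b = begin
    fromℕ (suc a ℕ.+ b)
  ≡⟨ fromℕ-suc (a ℕ.+ b) ⟩
    1ℚ ℚ.+ fromℕ (a ℕ.+ b)
  ≡⟨ cong (1ℚ ℚ.+_) (fromℕ-+ a b) ⟩
    1ℚ ℚ.+ (fromℕ a ℚ.+ fromℕ b)
  ≡⟨ sym (ℚP.+-assoc 1ℚ (fromℕ a) (fromℕ b)) ⟩
    (1ℚ ℚ.+ fromℕ a) ℚ.+ fromℕ b
  ≡⟨ cong (ℚ._+ fromℕ b) (sym (fromℕ-suc a)) ⟩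
    fromℕ (suc a) ℚ.+ fromℕ b ∎
  where open ≡-Reasoning

fromℕ-* : ∀ a b → fromℕ (a ℕ.* b) ≡ fromℕ a ℚ.* fromℕ b
fromℕ-* zero b = sym (ℚP.*-zeroˡ (fromℕ b))
fromℕ-* (suc a) b = begin
    fromℕ (b ℕ.+ a ℕ.* b)
  ≡⟨ fromℕ-+ b (a ℕ.* b) ⟩
    fromℕ b ℚ.+ fromℕ (a ℕ.* b)
  ≡⟨ cong₂ ℚ._+_ (sym (ℚP.*-identityˡ (fromℕ b))) (fromℕ-* a b) ⟩
    1ℚ ℚ.* fromℕ b ℚ.+ fromℕ a ℚ.* fromℕ b
  ≡⟨ sym (ℚP.*-distribʳ-+ (fromℕ b) 1ℚ (fromℕ a)) ⟩
    (1ℚ ℚ.+ fromℕ a) ℚ.* fromℕ b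
  ≡⟨ cong (ℚ._* fromℕ b) (sym (fromℕ-suc a)) ⟩
    fromℕ (suc a) ℚ.* fromℕ b ∎
  where open ≡-Reasoning

*-cancelʳ-fromℕ : ∀ d .{{_ : ℕ.NonZero d}} {x y} → x ℚ.* fromℕ d ≡ y ℚ.* fromℕ d → x ≡ y
*-cancelʳ-fromℕ d@(suc _) {x} {y} eq = ℚP.≤-antisym
  (ℚP.*-cancelʳ-≤-pos {x} {y} (fromℕ d) (ℚP.≤-reflexive eq))
  (ℚP.*-cancelʳ-≤-pos {y} {x} (fromℕ d) (ℚP.≤-reflexive (sym eq)))
  where instance _ = ℚP.normalize-pos d 1

cycles : ℕ → ℕ → ℕ
cycles zero zero = 1
cycles zero (suc k) = 0
cycles (suc n) zero = n ℕ.* cycles n zero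
cycles (suc n) (suc k) = cycles n k ℕ.+ n ℕ.* cycles n (suc k)

cycles-< : ∀ {n k} → n < k → cycles n k ≡ 0
cycles-< {zero} {suc k} _ = refl
cycles-< {suc n} {suc k} (s≤s n<k) = begin
    cycles n k ℕ.+ n ℕ.* cycles n (suc k)
  ≡⟨ cong₂ (λ a b → a ℕ.+ n ℕ.* b) (cycles-< n<k) (cycles-< (ℕP.m<n⇒m<1+n n<k)) ⟩
    n ℕ.* 0
  ≡⟨ ℕP.*-zeroʳ n ⟩
    0 ∎
  where open ≡-Reasoning

cycles-suc-zero : ∀ n → cycles (suc n) 0 ≡ 0
cycles-suc-zero zero = refl
cycles-suc-zero (suc n) = trans (cong (suc n ℕ.*_) (cycles-suc-zero n)) (ℕP.*-zeroʳ (suc n))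

neg1ℤ^ : ℕ → ℤ
neg1ℤ^ zero = + 1
neg1ℤ^ (suc p) = ℤ.- neg1ℤ^ p

∣neg1ℤ^*i∣≡∣i∣ : ∀ p i → ℤ.∣ neg1ℤ^ p ℤ.* i ∣ ≡ ℤ.∣ i ∣
∣neg1ℤ^*i∣≡∣i∣ zero i = cong ℤ.∣_∣ (ℤP.*-identityˡ i)
∣neg1ℤ^*i∣≡∣i∣ (suc p) i = begin
    ℤ.∣ ℤ.- neg1ℤ^ p ℤ.* i ∣
  ≡⟨ cong ℤ.∣_∣ (sym (ℤP.neg-distribˡ-* (neg1ℤ^ p) i)) ⟩
    ℤ.∣ ℤ.- (neg1ℤ^ p ℤ.* i) ∣
  ≡⟨ ℤP.∣-i∣≡∣i∣ (neg1ℤ^ p ℤ.* i) ⟩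
    ℤ.∣ neg1ℤ^ p ℤ.* i ∣
  ≡⟨ ∣neg1ℤ^*i∣≡∣i∣ p i ⟩
    ℤ.∣ i ∣ ∎
  where open ≡-Reasoning

S1≡neg1ℤ^*cycles : ∀ n k → S1 n k ≡ neg1ℤ^ (n ℕ.+ k) ℤ.* + cycles n k
S1≡neg1ℤ^*cycles zero zero = refl
S1≡neg1ℤ^*cycles zero (suc k) = sym (ℤP.*-zeroʳ (neg1ℤ^ (suc k)))
S1≡neg1ℤ^*cycles (suc n) zero = begin
    ℤ.- (+ n ℤ.* S1 n 0)
  ≡⟨ cong (λ z → ℤ.- (+ n ℤ.* z)) (S1≡neg1ℤ^*cycles n 0) ⟩
    ℤ.- (+ n ℤ.* (e ℤ.* + cycles n 0))
  ≡⟨ solve 3 (λ x e c → :- (x :* (e :* c)) := (:- e) :* (x :* c)) refl (+ n) e (+ cycles n 0) ⟩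
    ℤ.- e ℤ.* (+ n ℤ.* + cycles n 0)
  ≡⟨ cong (ℤ.- e ℤ.*_) (sym (ℤP.pos-* n (cycles n 0))) ⟩
    ℤ.- e ℤ.* + cycles (suc n) 0 ∎
  where
  open ≡-Reasoning
  open ℤSolver.+-*-Solver
  e = neg1ℤ^ (n ℕ.+ 0)
S1≡neg1ℤ^*cycles (suc n) (suc k) = begin
    S1 n k ℤ.- (+ n ℤ.* S1 n (suc k))
  ≡⟨ cong₂ (λ a b → a ℤ.- (+ n ℤ.* b)) (S1≡neg1ℤ^*cycles n k) (trans (S1≡neg1ℤ^*cycles n (suc k)) (cong (λ z → neg1ℤ^ z ℤ.* + cycles n (suc k)) (ℕP.+-suc n k))) ⟩
    e ℤ.* + cycles n k ℤ.- (+ n ℤ.* (ℤ.- e ℤ.* + cycles n (suc k)))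
  ≡⟨ solve 4 (λ e c₁ x c₂ → e :* c₁ :- (x :* ((:- e) :* c₂)) := (:- (:- e)) :* (c₁ :+ x :* c₂)) refl e (+ cycles n k) (+ n) (+ cycles n (suc k)) ⟩
    ℤ.- (ℤ.- e) ℤ.* (+ cycles n k ℤ.+ + n ℤ.* + cycles n (suc k))
  ≡⟨ cong₂ ℤ._*_ (cong (λ z → ℤ.- neg1ℤ^ z) (sym (ℕP.+-suc n k))) (sym (trans (ℤP.pos-+ (cycles n k) (n ℕ.* cycles n (suc k))) (cong (λ z → + cycles n k ℤ.+ z) (ℤP.pos-* n (cycles n (suc k)))))) ⟩
    neg1ℤ^ (suc n ℕ.+ suc k) ℤ.* + cycles (suc n) (suc k) ∎
  where
  open ≡-Reasoning
  open ℤSolver.+-*-Solver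
  e = neg1ℤ^ (n ℕ.+ k)

∣S1∣≡cycles : ∀ n k → ℤ.∣ S1 n k ∣ ≡ cycles n k
∣S1∣≡cycles n k = trans (cong ℤ.∣_∣ (S1≡neg1ℤ^*cycles n k)) (∣neg1ℤ^*i∣≡∣i∣ (n ℕ.+ k) (+ cycles n k))

open ℚSolver.+-*-Solver

opaque
  Σ : ℕ → (ℕ → ℚ) → ℚ
  Σ zero f = 0ℚ
  Σ (suc n) f = f 0 ℚ.+ Σ n (λ i → f (suc i))

  Σ-zero : ∀ f → Σ 0 f ≡ 0ℚ
  Σ-zero f = refl

  Σ-suc : ∀ n f → Σ (suc n) f ≡ f 0 ℚ.+ Σ n (λ i → f (suc i))
  Σ-suc n f = refl

  Σ-cong< : ∀ n {f g : ℕ → ℚ} → (∀ i → i < n → f i ≡ g i) → Σ n f ≡ Σ n g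
  Σ-cong< zero h = refl
  Σ-cong< (suc n) h = cong₂ ℚ._+_ (h 0 (s≤s z≤n)) (Σ-cong< n (λ i i<n → h (suc i) (s≤s i<n)))

  Σ-≡0 : ∀ n {f : ℕ → ℚ} → (∀ i → i < n → f i ≡ 0ℚ) → Σ n f ≡ 0ℚ
  Σ-≡0 zero h = refl
  Σ-≡0 (suc n) h = trans (cong₂ ℚ._+_ (h 0 (s≤s z≤n)) (Σ-≡0 n (λ i i<n → h (suc i) (s≤s i<n)))) (ℚP.+-identityˡ 0ℚ)

  Σ-+ : ∀ n (f g : ℕ → ℚ) → Σ n (λ i → f i ℚ.+ g i) ≡ Σ n f ℚ.+ Σ n g
  Σ-+ zero f g = refl
  Σ-+ (suc n) f g = trans (cong ((f 0 ℚ.+ g 0) ℚ.+_) (Σ-+ n (λ i → f (suc i)) (λ i → g (suc i))))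
    (solve 4 (λ a b c d → (a :+ b) :+ (c :+ d) := (a :+ c) :+ (b :+ d)) refl (f 0) (g 0) (Σ n (λ i → f (suc i))) (Σ n (λ i → g (suc i))))

  Σ-distribˡ : ∀ n c (f : ℕ → ℚ) → Σ n (λ i → c ℚ.* f i) ≡ c ℚ.* Σ n f
  Σ-distribˡ zero c f = sym (ℚP.*-zeroʳ c)
  Σ-distribˡ (suc n) c f = trans (cong (c ℚ.* f 0 ℚ.+_) (Σ-distribˡ n c (λ i → f (suc i)))) (sym (ℚP.*-distribˡ-+ c (f 0) _))

  Σ-neg : ∀ n (f : ℕ → ℚ) → Σ n (λ i → ℚ.- f i) ≡ ℚ.- Σ n f
  Σ-neg zero f = refl
  Σ-neg (suc n) f = trans (cong (ℚ.- f 0 ℚ.+_) (Σ-neg n (λ i → f (suc i)))) (sym (ℚP.neg-distrib-+ (f 0) _))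

  Σ-split : ∀ a b (f : ℕ → ℚ) → Σ (a ℕ.+ b) f ≡ Σ a f ℚ.+ Σ b (λ i → f (a ℕ.+ i))
  Σ-split zero b f = sym (ℚP.+-identityˡ _)
  Σ-split (suc a) b f = trans (cong (f 0 ℚ.+_) (Σ-split a b (λ i → f (suc i)))) (sym (ℚP.+-assoc (f 0) _ _))

  Σ-cong : ∀ n {f g : ℕ → ℚ} → (∀ i → f i ≡ g i) → Σ n f ≡ Σ n g
  Σ-cong n h = Σ-cong< n (λ i _ → h i)

  Σ-distribʳ : ∀ n c (f : ℕ → ℚ) → Σ n (λ i → f i ℚ.* c) ≡ Σ n f ℚ.* c
  Σ-distribʳ n c f = trans (Σ-cong n (λ i → ℚP.*-comm (f i) c)) (trans (Σ-distribˡ n c f) (ℚP.*-comm c _))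

  Σ-last : ∀ n (f : ℕ → ℚ) → Σ (suc n) f ≡ Σ n f ℚ.+ f n
  Σ-last n f = begin
      Σ (suc n) f
    ≡⟨ cong (λ m → Σ m f) (ℕP.+-comm 1 n) ⟩
      Σ (n ℕ.+ 1) f
    ≡⟨ Σ-split n 1 f ⟩
      Σ n f ℚ.+ (f (n ℕ.+ 0) ℚ.+ 0ℚ)
    ≡⟨ cong (Σ n f ℚ.+_) (trans (ℚP.+-identityʳ _) (cong f (ℕP.+-identityʳ n))) ⟩
      Σ n f ℚ.+ f n ∎
    where open ≡-Reasoning

  Σ-reverse : ∀ n (f : ℕ → ℚ) → Σ (suc n) f ≡ Σ (suc n) (λ i → f (n ∸ i))
  Σ-reverse zero f = refl
  Σ-reverse (suc n) f = begin
      f 0 ℚ.+ Σ (suc n) (λ i → f (suc i))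
    ≡⟨ cong (f 0 ℚ.+_) (Σ-reverse n (λ i → f (suc i))) ⟩
      f 0 ℚ.+ Σ (suc n) (λ i → f (suc (n ∸ i)))
    ≡⟨ ℚP.+-comm (f 0) _ ⟩
      Σ (suc n) (λ i → f (suc (n ∸ i))) ℚ.+ f 0
    ≡⟨ cong₂ ℚ._+_ (Σ-cong< (suc n) (λ i i<sn → cong f (sym (ℕP.+-∸-assoc 1 (ℕP.≤-pred i<sn))))) (cong f (sym (ℕP.n∸n≡0 (suc n)))) ⟩
      Σ (suc n) (λ i → f (suc n ∸ i)) ℚ.+ f (suc n ∸ suc n)
    ≡⟨ sym (Σ-last (suc n) (λ i → f (suc n ∸ i))) ⟩
      Σ (suc (suc n)) (λ i → f (suc n ∸ i)) ∎
    where open ≡-Reasoning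

  Σ-swap : ∀ a b (F : ℕ → ℕ → ℚ) → Σ a (λ i → Σ b (F i)) ≡ Σ b (λ j → Σ a (λ i → F i j))
  Σ-swap zero b F = sym (Σ-≡0 b (λ _ _ → refl))
  Σ-swap (suc a) b F = trans (cong (Σ b (F 0) ℚ.+_) (Σ-swap a b (λ i → F (suc i)))) (sym (Σ-+ b (F 0) (λ j → Σ a (λ i → F (suc i) j))))

  Σ-triangle : ∀ n (F : ℕ → ℕ → ℚ) → Σ (suc n) (λ i → Σ (suc i) (λ j → F j (i ∸ j))) ≡ Σ (suc n) (λ j → Σ (suc (n ∸ j)) (F j))
  Σ-triangle zero F = refl
  Σ-triangle (suc n) F = begin
      (F 0 0 ℚ.+ 0ℚ) ℚ.+ Σ (suc n) (λ i → F 0 (suc i) ℚ.+ Σ (suc i) (λ j → F (suc j) (i ∸ j)))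
    ≡⟨ cong ((F 0 0 ℚ.+ 0ℚ) ℚ.+_) (Σ-+ (suc n) (λ i → F 0 (suc i)) (λ i → Σ (suc i) (λ j → F (suc j) (i ∸ j)))) ⟩
      (F 0 0 ℚ.+ 0ℚ) ℚ.+ (Σ (suc n) (λ i → F 0 (suc i)) ℚ.+ Σ (suc n) (λ i → Σ (suc i) (λ j → F (suc j) (i ∸ j))))
    ≡⟨ cong (λ z → (F 0 0 ℚ.+ 0ℚ) ℚ.+ (Σ (suc n) (λ i → F 0 (suc i)) ℚ.+ z)) (Σ-triangle n (λ j → F (suc j))) ⟩
      (F 0 0 ℚ.+ 0ℚ) ℚ.+ (Σ (suc n) (λ i → F 0 (suc i)) ℚ.+ Σ (suc n) (λ j → Σ (suc (n ∸ j)) (F (suc j))))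
    ≡⟨ solve 3 (λ a b c → (a :+ con 0ℚ) :+ (b :+ c) := (a :+ b) :+ c) refl (F 0 0) _ _ ⟩
      (F 0 0 ℚ.+ Σ (suc n) (λ i → F 0 (suc i))) ℚ.+ Σ (suc n) (λ j → Σ (suc (n ∸ j)) (F (suc j))) ∎
    where open ≡-Reasoning

sumMap : {A : Set} → (A → ℚ) → List A → ℚ
sumMap F xs = sumℚ (map F xs)

sumMap-cong : {A : Set} {F G : A → ℚ} (xs : List A) → (∀ x → F x ≡ G x) → sumMap F xs ≡ sumMap G xs
sumMap-cong [] h = refl
sumMap-cong (x ∷ xs) h = cong₂ ℚ._+_ (h x) (sumMap-cong xs h)

sumMap-≡0 : {A : Set} {F : A → ℚ} (xs : List A) → (∀ x → F x ≡ 0ℚ) → sumMap F xs ≡ 0ℚ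
sumMap-≡0 [] h = refl
sumMap-≡0 (x ∷ xs) h = trans (cong₂ ℚ._+_ (h x) (sumMap-≡0 xs h)) (ℚP.+-identityˡ 0ℚ)

sumMap-distribˡ : {A : Set} (c : ℚ) (F : A → ℚ) (xs : List A) → sumMap (λ x → c ℚ.* F x) xs ≡ c ℚ.* sumMap F xs
sumMap-distribˡ c F [] = sym (ℚP.*-zeroʳ c)
sumMap-distribˡ c F (x ∷ xs) = trans (cong (c ℚ.* F x ℚ.+_) (sumMap-distribˡ c F xs)) (sym (ℚP.*-distribˡ-+ c (F x) _))

sumMap-applyUpTo : {A : Set} (F : A → ℚ) (g : ℕ → A) (n : ℕ) → sumMap F (applyUpTo g n) ≡ Σ n (λ i → F (g i))
sumMap-applyUpTo F g zero = sym (Σ-zero _)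
sumMap-applyUpTo F g (suc n) = trans (cong (F (g 0) ℚ.+_) (sumMap-applyUpTo F (λ i → g (suc i)) n)) (sym (Σ-suc n _))

sumMap-upTo : (F : ℕ → ℚ) (n : ℕ) → sumMap F (upTo n) ≡ Σ n F
sumMap-upTo F n = sumMap-applyUpTo F (λ i → i) n

sumMap-++ : {A : Set} (F : A → ℚ) (xs ys : List A) → sumMap F (xs ++ ys) ≡ sumMap F xs ℚ.+ sumMap F ys
sumMap-++ F [] ys = sym (ℚP.+-identityˡ _)
sumMap-++ F (x ∷ xs) ys = trans (cong (F x ℚ.+_) (sumMap-++ F xs ys)) (sym (ℚP.+-assoc (F x) _ _))

sumMap-map : {A B : Set} (F : B → ℚ) (g : A → B) (xs : List A) → sumMap F (map g xs) ≡ sumMap (λ x → F (g x)) xs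
sumMap-map F g [] = refl
sumMap-map F g (x ∷ xs) = cong (F (g x) ℚ.+_) (sumMap-map F g xs)

sumMap-concatMap : {A B : Set} (F : B → ℚ) (G : A → List B) (xs : List A) → sumMap F (concatMap G xs) ≡ sumMap (λ x → sumMap F (G x)) xs
sumMap-concatMap F G [] = refl
sumMap-concatMap F G (x ∷ xs) = trans (sumMap-++ F (G x) (concat (map G xs))) (cong (sumMap F (G x) ℚ.+_) (sumMap-concatMap F G xs))

iverson : {P : Set} → Dec P → ℚ → ℚ
iverson (yes _) q = q
iverson (no _) q = 0ℚ

sumMap-filter : {A : Set} {P : Pred A _} (P? : Decidable P) (F : A → ℚ) (xs : List A) → sumMap F (filter P? xs) ≡ sumMap (λ x → iverson (P? x) (F x)) xs
sumMap-filter P? F [] = refl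
sumMap-filter P? F (x ∷ xs) with P? x
... | yes _ = cong (F x ℚ.+_) (sumMap-filter P? F xs)
... | no _ = trans (sumMap-filter P? F xs) (sym (ℚP.+-identityˡ _))

fromℕ-sumℕ : {A : Set} (F : A → ℕ) (xs : List A) → fromℕ (sumℕ (map F xs)) ≡ sumMap (λ x → fromℕ (F x)) xs
fromℕ-sumℕ F [] = refl
fromℕ-sumℕ F (x ∷ xs) = trans (fromℕ-+ (F x) _) (cong (fromℕ (F x) ℚ.+_) (fromℕ-sumℕ F xs))

-- Formal power series

_⊕_ : PS → PS → PS
(a ⊕ b) n = a n ℚ.+ b n

⊝_ : PS → PS
(⊝ a) n = ℚ.- a n

scale : ℚ → PS → PS
scale c a n = c ℚ.* a n

-- The Euler operator θ = t d/dt.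
θ : PS → PS
θ a n = fromℕ n ℚ.* a n

t*_ : PS → PS
(t* a) zero = 0ℚ
(t* a) (suc n) = a n

⊛≡Σ : ∀ (a b : PS) n → (a ⊛ b) n ≡ Σ (suc n) (λ i → a i ℚ.* b (n ∸ i))
⊛≡Σ a b n = sumMap-upTo (λ i → a i ℚ.* b (n ∸ i)) (suc n)

⊛-cong : ∀ {a a′ b b′ : PS} → a ≗ a′ → b ≗ b′ → (a ⊛ b) ≗ (a′ ⊛ b′)
⊛-cong {a} {a′} {b} {b′} a≗a′ b≗b′ n = begin
    (a ⊛ b) n
  ≡⟨ ⊛≡Σ a b n ⟩
    Σ (suc n) (λ i → a i ℚ.* b (n ∸ i))
  ≡⟨ Σ-cong (suc n) (λ i → cong₂ ℚ._*_ (a≗a′ i) (b≗b′ (n ∸ i))) ⟩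
    Σ (suc n) (λ i → a′ i ℚ.* b′ (n ∸ i))
  ≡⟨ sym (⊛≡Σ a′ b′ n) ⟩
    (a′ ⊛ b′) n ∎
  where open ≡-Reasoning

⊛-congʳ : ∀ (a : PS) {b b′ : PS} → b ≗ b′ → (a ⊛ b) ≗ (a ⊛ b′)
⊛-congʳ a = ⊛-cong {a} {a} (λ _ → refl)

⊛-comm : ∀ (a b : PS) → (a ⊛ b) ≗ (b ⊛ a)
⊛-comm a b n = begin
    (a ⊛ b) n
  ≡⟨ ⊛≡Σ a b n ⟩
    Σ (suc n) (λ i → a i ℚ.* b (n ∸ i))
  ≡⟨ Σ-reverse n (λ i → a i ℚ.* b (n ∸ i)) ⟩
    Σ (suc n) (λ i → a (n ∸ i) ℚ.* b (n ∸ (n ∸ i)))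
  ≡⟨ Σ-cong< (suc n) (λ i i<sn → trans (cong (λ z → a (n ∸ i) ℚ.* b z) (ℕP.m∸[m∸n]≡n (ℕP.≤-pred i<sn))) (ℚP.*-comm (a (n ∸ i)) (b i))) ⟩
    Σ (suc n) (λ i → b i ℚ.* a (n ∸ i))
  ≡⟨ sym (⊛≡Σ b a n) ⟩
    (b ⊛ a) n ∎
  where open ≡-Reasoning

⊛-assoc : ∀ (a b c : PS) → ((a ⊛ b) ⊛ c) ≗ (a ⊛ (b ⊛ c))
⊛-assoc a b c n = begin
    ((a ⊛ b) ⊛ c) n
  ≡⟨ ⊛≡Σ (a ⊛ b) c n ⟩
    Σ (suc n) (λ i → (a ⊛ b) i ℚ.* c (n ∸ i))
  ≡⟨ Σ-cong (suc n) (λ i → trans (cong (ℚ._* c (n ∸ i)) (⊛≡Σ a b i)) (sym (Σ-distribʳ (suc i) (c (n ∸ i)) (λ j → a j ℚ.* b (i ∸ j))))) ⟩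
    Σ (suc n) (λ i → Σ (suc i) (λ j → (a j ℚ.* b (i ∸ j)) ℚ.* c (n ∸ i)))
  ≡⟨ Σ-cong (suc n) (λ i → Σ-cong< (suc i) (λ j j<si → trans (ℚP.*-assoc (a j) _ _) (cong (λ z → a j ℚ.* (b (i ∸ j) ℚ.* c z)) (n∸i≡n∸j∸[i∸j] i j (ℕP.≤-pred j<si))))) ⟩
    Σ (suc n) (λ i → Σ (suc i) (λ j → F j (i ∸ j)))
  ≡⟨ Σ-triangle n F ⟩
    Σ (suc n) (λ j → Σ (suc (n ∸ j)) (F j))
  ≡⟨ Σ-cong (suc n) (λ j → trans (Σ-distribˡ (suc (n ∸ j)) (a j) (λ l → b l ℚ.* c (n ∸ j ∸ l))) (cong (a j ℚ.*_) (sym (⊛≡Σ b c (n ∸ j))))) ⟩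
    Σ (suc n) (λ j → a j ℚ.* (b ⊛ c) (n ∸ j))
  ≡⟨ sym (⊛≡Σ a (b ⊛ c) n) ⟩
    (a ⊛ (b ⊛ c)) n ∎
  where
  open ≡-Reasoning
  F : ℕ → ℕ → ℚ
  F j l = a j ℚ.* (b l ℚ.* c (n ∸ j ∸ l))
  n∸i≡n∸j∸[i∸j] : ∀ i j → j ≤ i → n ∸ i ≡ n ∸ j ∸ (i ∸ j)
  n∸i≡n∸j∸[i∸j] i j j≤i = sym (trans (ℕP.∸-+-assoc n j (i ∸ j)) (cong (n ∸_) (ℕP.m+[n∸m]≡n j≤i)))

⊛-distribˡ-⊕ : ∀ (a b c : PS) → (a ⊛ (b ⊕ c)) ≗ ((a ⊛ b) ⊕ (a ⊛ c))
⊛-distribˡ-⊕ a b c n = begin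
    (a ⊛ (b ⊕ c)) n
  ≡⟨ ⊛≡Σ a (b ⊕ c) n ⟩
    Σ (suc n) (λ i → a i ℚ.* (b (n ∸ i) ℚ.+ c (n ∸ i)))
  ≡⟨ Σ-cong (suc n) (λ i → ℚP.*-distribˡ-+ (a i) _ _) ⟩
    Σ (suc n) (λ i → a i ℚ.* b (n ∸ i) ℚ.+ a i ℚ.* c (n ∸ i))
  ≡⟨ Σ-+ (suc n) (λ i → a i ℚ.* b (n ∸ i)) (λ i → a i ℚ.* c (n ∸ i)) ⟩
    Σ (suc n) (λ i → a i ℚ.* b (n ∸ i)) ℚ.+ Σ (suc n) (λ i → a i ℚ.* c (n ∸ i))
  ≡⟨ sym (cong₂ ℚ._+_ (⊛≡Σ a b n) (⊛≡Σ a c n)) ⟩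
    (a ⊛ b) n ℚ.+ (a ⊛ c) n ∎
  where open ≡-Reasoning

⊛-scaleʳ : ∀ (a b : PS) q → (a ⊛ scale q b) ≗ scale q (a ⊛ b)
⊛-scaleʳ a b q n = begin
    (a ⊛ scale q b) n
  ≡⟨ ⊛≡Σ a (scale q b) n ⟩
    Σ (suc n) (λ i → a i ℚ.* (q ℚ.* b (n ∸ i)))
  ≡⟨ Σ-cong (suc n) (λ i → solve 3 (λ x y z → x :* (y :* z) := y :* (x :* z)) refl (a i) q (b (n ∸ i))) ⟩
    Σ (suc n) (λ i → q ℚ.* (a i ℚ.* b (n ∸ i)))
  ≡⟨ Σ-distribˡ (suc n) q (λ i → a i ℚ.* b (n ∸ i)) ⟩
    q ℚ.* Σ (suc n) (λ i → a i ℚ.* b (n ∸ i))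
  ≡⟨ cong (q ℚ.*_) (sym (⊛≡Σ a b n)) ⟩
    q ℚ.* (a ⊛ b) n ∎
  where open ≡-Reasoning

⊛-negʳ : ∀ (a b : PS) → (a ⊛ (⊝ b)) ≗ (⊝ (a ⊛ b))
⊛-negʳ a b n = begin
    (a ⊛ (⊝ b)) n
  ≡⟨ ⊛≡Σ a (⊝ b) n ⟩
    Σ (suc n) (λ i → a i ℚ.* ℚ.- b (n ∸ i))
  ≡⟨ Σ-cong (suc n) (λ i → sym (ℚP.neg-distribʳ-* (a i) _)) ⟩
    Σ (suc n) (λ i → ℚ.- (a i ℚ.* b (n ∸ i)))
  ≡⟨ Σ-neg (suc n) (λ i → a i ℚ.* b (n ∸ i)) ⟩
    ℚ.- Σ (suc n) (λ i → a i ℚ.* b (n ∸ i))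
  ≡⟨ cong ℚ.-_ (sym (⊛≡Σ a b n)) ⟩
    ℚ.- (a ⊛ b) n ∎
  where open ≡-Reasoning

⊛-distribˡ-⊕-⊝ : ∀ (a x y z : PS) n → (a ⊛ ((x ⊕ y) ⊕ (⊝ z))) n ≡ ((a ⊛ x) n ℚ.+ (a ⊛ y) n) ℚ.- (a ⊛ z) n
⊛-distribˡ-⊕-⊝ a x y z n = trans (⊛-distribˡ-⊕ a (x ⊕ y) (⊝ z) n) (cong₂ ℚ._+_ (⊛-distribˡ-⊕ a x y n) (⊛-negʳ a z n))

⊛-distribˡ-⊝-⊝ : ∀ (a x y z : PS) n → (a ⊛ ((x ⊕ (⊝ y)) ⊕ (⊝ z))) n ≡ ((a ⊛ x) n ℚ.- (a ⊛ y) n) ℚ.- (a ⊛ z) n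
⊛-distribˡ-⊝-⊝ a x y z n = trans (⊛-distribˡ-⊕-⊝ a x (⊝ y) z n) (cong (λ w → ((a ⊛ x) n ℚ.+ w) ℚ.- (a ⊛ z) n) (⊛-negʳ a y n))

⊛-identityˡ : ∀ (a : PS) → (onePS ⊛ a) ≗ a
⊛-identityˡ a n = begin
    (onePS ⊛ a) n
  ≡⟨ ⊛≡Σ onePS a n ⟩
    Σ (suc n) (λ i → onePS i ℚ.* a (n ∸ i))
  ≡⟨ Σ-suc n _ ⟩
    1ℚ ℚ.* a n ℚ.+ Σ n (λ i → 0ℚ ℚ.* a (n ∸ suc i))
  ≡⟨ cong₂ ℚ._+_ (ℚP.*-identityˡ (a n)) (Σ-≡0 n (λ i _ → ℚP.*-zeroˡ (a (n ∸ suc i)))) ⟩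
    a n ℚ.+ 0ℚ
  ≡⟨ ℚP.+-identityʳ (a n) ⟩
    a n ∎
  where open ≡-Reasoning

⊛-identityʳ : ∀ (a : PS) → (a ⊛ onePS) ≗ a
⊛-identityʳ a n = trans (⊛-comm a onePS n) (⊛-identityˡ a n)

t*-cong : ∀ {a b : PS} → a ≗ b → (t* a) ≗ (t* b)
t*-cong a≗b zero = refl
t*-cong a≗b (suc n) = a≗b n

t*-⊛ˡ : ∀ (a b : PS) → ((t* a) ⊛ b) ≗ (t* (a ⊛ b))
t*-⊛ˡ a b zero = begin
    ((t* a) ⊛ b) 0
  ≡⟨ ⊛≡Σ (t* a) b 0 ⟩
    Σ 1 (λ i → (t* a) i ℚ.* b (0 ∸ i))
  ≡⟨ Σ-suc 0 _ ⟩
    0ℚ ℚ.* b 0 ℚ.+ Σ 0 (λ i → a i ℚ.* b 0)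
  ≡⟨ cong₂ ℚ._+_ (ℚP.*-zeroˡ (b 0)) (Σ-zero _) ⟩
    0ℚ ∎
  where open ≡-Reasoning
t*-⊛ˡ a b (suc n) = begin
    ((t* a) ⊛ b) (suc n)
  ≡⟨ ⊛≡Σ (t* a) b (suc n) ⟩
    Σ (suc (suc n)) (λ i → (t* a) i ℚ.* b (suc n ∸ i))
  ≡⟨ Σ-suc (suc n) _ ⟩
    0ℚ ℚ.* b (suc n) ℚ.+ Σ (suc n) (λ i → a i ℚ.* b (n ∸ i))
  ≡⟨ cong (ℚ._+ Σ (suc n) (λ i → a i ℚ.* b (n ∸ i))) (ℚP.*-zeroˡ (b (suc n))) ⟩
    0ℚ ℚ.+ Σ (suc n) (λ i → a i ℚ.* b (n ∸ i))
  ≡⟨ ℚP.+-identityˡ _ ⟩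
    Σ (suc n) (λ i → a i ℚ.* b (n ∸ i))
  ≡⟨ sym (⊛≡Σ a b n) ⟩
    (a ⊛ b) n ∎
  where open ≡-Reasoning

t*-⊛ʳ : ∀ (a b : PS) → (a ⊛ (t* b)) ≗ (t* (a ⊛ b))
t*-⊛ʳ a b n = trans (⊛-comm a (t* b) n) (trans (t*-⊛ˡ b a n) (t*-cong (⊛-comm b a) n))

θ-onePS : θ onePS ≗ (λ _ → 0ℚ)
θ-onePS zero = refl
θ-onePS (suc n) = ℚP.*-zeroʳ (fromℕ (suc n))

θ-⊛ : ∀ (a b : PS) → θ (a ⊛ b) ≗ ((θ a ⊛ b) ⊕ (a ⊛ θ b))
θ-⊛ a b n = begin
    fromℕ n ℚ.* (a ⊛ b) n
  ≡⟨ cong (fromℕ n ℚ.*_) (⊛≡Σ a b n) ⟩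
    fromℕ n ℚ.* Σ (suc n) (λ i → a i ℚ.* b (n ∸ i))
  ≡⟨ sym (Σ-distribˡ (suc n) (fromℕ n) (λ i → a i ℚ.* b (n ∸ i))) ⟩
    Σ (suc n) (λ i → fromℕ n ℚ.* (a i ℚ.* b (n ∸ i)))
  ≡⟨ Σ-cong< (suc n) (λ i i<sn → split i (ℕP.≤-pred i<sn)) ⟩
    Σ (suc n) (λ i → (fromℕ i ℚ.* a i) ℚ.* b (n ∸ i) ℚ.+ a i ℚ.* (fromℕ (n ∸ i) ℚ.* b (n ∸ i)))
  ≡⟨ Σ-+ (suc n) (λ i → (fromℕ i ℚ.* a i) ℚ.* b (n ∸ i)) (λ i → a i ℚ.* (fromℕ (n ∸ i) ℚ.* b (n ∸ i))) ⟩
    Σ (suc n) (λ i → (fromℕ i ℚ.* a i) ℚ.* b (n ∸ i)) ℚ.+ Σ (suc n) (λ i → a i ℚ.* (fromℕ (n ∸ i) ℚ.* b (n ∸ i)))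
  ≡⟨ sym (cong₂ ℚ._+_ (⊛≡Σ (θ a) b n) (⊛≡Σ a (θ b) n)) ⟩
    (θ a ⊛ b) n ℚ.+ (a ⊛ θ b) n ∎
  where
  open ≡-Reasoning
  split : ∀ i → i ≤ n → fromℕ n ℚ.* (a i ℚ.* b (n ∸ i)) ≡ (fromℕ i ℚ.* a i) ℚ.* b (n ∸ i) ℚ.+ a i ℚ.* (fromℕ (n ∸ i) ℚ.* b (n ∸ i))
  split i i≤n = begin
      fromℕ n ℚ.* (a i ℚ.* b (n ∸ i))
    ≡⟨ cong (λ z → fromℕ z ℚ.* (a i ℚ.* b (n ∸ i))) (sym (ℕP.m+[n∸m]≡n i≤n)) ⟩
      fromℕ (i ℕ.+ (n ∸ i)) ℚ.* (a i ℚ.* b (n ∸ i))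
    ≡⟨ cong (ℚ._* (a i ℚ.* b (n ∸ i))) (fromℕ-+ i (n ∸ i)) ⟩
      (fromℕ i ℚ.+ fromℕ (n ∸ i)) ℚ.* (a i ℚ.* b (n ∸ i))
    ≡⟨ solve 4 (λ x y p q → (x :+ y) :* (p :* q) := (x :* p) :* q :+ p :* (y :* q)) refl (fromℕ i) (fromℕ (n ∸ i)) (a i) (b (n ∸ i)) ⟩
      (fromℕ i ℚ.* a i) ℚ.* b (n ∸ i) ℚ.+ a i ℚ.* (fromℕ (n ∸ i) ℚ.* b (n ∸ i)) ∎

-- inv1PS in Defs is computed with a private helper; weightedTail is a copy of it.
weightedTail : PS → ℕ → List ℚ → ℚ
weightedTail h i [] = 0ℚ
weightedTail h i (x ∷ xs) = h (suc i) ℚ.* x ℚ.+ weightedTail h (suc i) xs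

weightedTail-unique : (h : PS) {Z : ℕ → List ℚ → ℚ} {z : ℚ} → z ≡ 0ℚ → (∀ i → Z i [] ≡ z) →
  (∀ i x xs → Z i (x ∷ xs) ≡ h (suc i) ℚ.* x ℚ.+ Z (suc i) xs) →
  ∀ i xs → Z i xs ≡ weightedTail h i xs
weightedTail-unique h z≡0 Z[] Z∷ i [] = trans (Z[] i) z≡0
weightedTail-unique h {Z} z≡0 Z[] Z∷ i (x ∷ xs) = trans (Z∷ i x xs) (cong (h (suc i) ℚ.* x ℚ.+_) (weightedTail-unique h {Z} z≡0 Z[] Z∷ (suc i) xs))

inv1PS-suc : (h : PS) (n : ℕ) → inv1PS h (suc n) ≡ ℚ.- weightedTail h 0 (invRev h n)
inv1PS-suc h n = viaUnification 0ℚ refl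
  where
  -- The private helper cannot be named; abstracting its arguments lets unification solve Z for it.
  -- The constant 0ℚ is hidden behind z because its normal form contains the abstracted literal 0.
  viaUnification : (z : ℚ) → z ≡ 0ℚ → inv1PS h (suc n) ≡ ℚ.- weightedTail h 0 (invRev h n)
  viaUnification z z≡0 with invRev h n | 0 | weightedTail-unique h {_} {z} z≡0
  ... | xs | i | unique = cong ℚ.-_ (unique (λ _ → sym z≡0) (λ _ _ _ → refl) i xs)

weightedTail-invRev : ∀ h n s → weightedTail h s (invRev h n) ≡ Σ (suc n) (λ i → h (suc (s ℕ.+ i)) ℚ.* inv1PS h (n ∸ i))
weightedTail-invRev h zero s = sym (trans (Σ-suc 0 _) (cong₂ ℚ._+_ (cong (λ z → h (suc z) ℚ.* 1ℚ) (ℕP.+-identityʳ s)) (Σ-zero _)))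
weightedTail-invRev h (suc n) s = begin
    h (suc s) ℚ.* inv1PS h (suc n) ℚ.+ weightedTail h (suc s) (invRev h n)
  ≡⟨ cong (h (suc s) ℚ.* inv1PS h (suc n) ℚ.+_) (weightedTail-invRev h n (suc s)) ⟩
    h (suc s) ℚ.* inv1PS h (suc n) ℚ.+ Σ (suc n) (λ i → h (suc (suc s ℕ.+ i)) ℚ.* inv1PS h (n ∸ i))
  ≡⟨ cong₂ ℚ._+_ (cong (λ z → h (suc z) ℚ.* inv1PS h (suc n)) (sym (ℕP.+-identityʳ s))) (Σ-cong (suc n) (λ i → cong (λ z → h (suc z) ℚ.* inv1PS h (n ∸ i)) (sym (ℕP.+-suc s i)))) ⟩
    h (suc (s ℕ.+ 0)) ℚ.* inv1PS h (suc n) ℚ.+ Σ (suc n) (λ i → h (suc (s ℕ.+ suc i)) ℚ.* inv1PS h (n ∸ i))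
  ≡⟨ sym (Σ-suc (suc n) (λ i → h (suc (s ℕ.+ i)) ℚ.* inv1PS h (suc n ∸ i))) ⟩
    Σ (suc (suc n)) (λ i → h (suc (s ℕ.+ i)) ℚ.* inv1PS h (suc n ∸ i)) ∎
  where open ≡-Reasoning

⊛-inv1PS : ∀ h → h 0 ≡ 1ℚ → (h ⊛ inv1PS h) ≗ onePS
⊛-inv1PS h h₀≡1 zero = trans (ℚP.+-identityʳ (h 0 ℚ.* 1ℚ)) (trans (ℚP.*-identityʳ (h 0)) h₀≡1)
⊛-inv1PS h h₀≡1 (suc n) = begin
    (h ⊛ inv1PS h) (suc n)
  ≡⟨ ⊛≡Σ h (inv1PS h) (suc n) ⟩
    Σ (suc (suc n)) (λ i → h i ℚ.* inv1PS h (suc n ∸ i))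
  ≡⟨ Σ-suc (suc n) _ ⟩
    h 0 ℚ.* inv1PS h (suc n) ℚ.+ Σ (suc n) (λ i → h (suc i) ℚ.* inv1PS h (n ∸ i))
  ≡⟨ cong₂ ℚ._+_ (trans (cong (ℚ._* inv1PS h (suc n)) h₀≡1) (trans (ℚP.*-identityˡ _) (inv1PS-suc h n))) (sym (weightedTail-invRev h n 0)) ⟩
    ℚ.- T ℚ.+ T
  ≡⟨ ℚP.+-inverseˡ T ⟩
    0ℚ ∎
  where
  open ≡-Reasoning
  T = weightedTail h 0 (invRev h n)

g : PS
g = expm1OverT

f : PS
f = tOverExpm1

g⊛f≗1 : (g ⊛ f) ≗ onePS
g⊛f≗1 = ⊛-inv1PS g refl

f⊛g≗1 : (f ⊛ g) ≗ onePS
f⊛g≗1 n = trans (⊛-comm f g n) (g⊛f≗1 n)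

-- t g′ = e^t - g = 1 + t g - g
θg : ∀ n → θ g n ≡ (onePS n ℚ.+ (t* g) n) ℚ.- g n
θg zero = refl
θg (suc n) = *-cancelʳ-fromℕ d (begin
    (fromℕ (suc n) ℚ.* ((+ 1) / d)) ℚ.* fromℕ d
  ≡⟨ ℚP.*-assoc (fromℕ (suc n)) _ _ ⟩
    fromℕ (suc n) ℚ.* (((+ 1) / d) ℚ.* fromℕ d)
  ≡⟨ cong (fromℕ (suc n) ℚ.*_) (/-*-cancel 1 d) ⟩
    fromℕ (suc n) ℚ.* 1ℚ
  ≡⟨ solve 1 (λ x → x :* con 1ℚ := ((con 1ℚ :+ x) :* con 1ℚ) :- con 1ℚ) refl (fromℕ (suc n)) ⟩
    ((1ℚ ℚ.+ fromℕ (suc n)) ℚ.* 1ℚ) ℚ.- 1ℚ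
  ≡⟨ cong (λ z → (z ℚ.* 1ℚ) ℚ.- 1ℚ) (sym (fromℕ-suc (suc n))) ⟩
    (fromℕ (suc (suc n)) ℚ.* 1ℚ) ℚ.- 1ℚ
  ≡⟨ cong₂ ℚ._-_ (cong (fromℕ (suc (suc n)) ℚ.*_) (sym (/-*-cancel 1 F))) (sym (/-*-cancel 1 d)) ⟩
    (fromℕ (suc (suc n)) ℚ.* (((+ 1) / F) ℚ.* fromℕ F)) ℚ.- ((+ 1) / d) ℚ.* fromℕ d
  ≡⟨ cong (λ z → z ℚ.- ((+ 1) / d) ℚ.* fromℕ d) (trans (solve 3 (λ a b c → a :* (b :* c) := b :* (a :* c)) refl (fromℕ (suc (suc n))) ((+ 1) / F) (fromℕ F)) (cong (((+ 1) / F) ℚ.*_) (sym (fromℕ-* (suc (suc n)) F)))) ⟩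
    ((+ 1) / F) ℚ.* fromℕ d ℚ.- ((+ 1) / d) ℚ.* fromℕ d
  ≡⟨ solve 3 (λ a b c → a :* c :- b :* c := ((con 0ℚ :+ a) :- b) :* c) refl ((+ 1) / F) ((+ 1) / d) (fromℕ d) ⟩
    ((0ℚ ℚ.+ (+ 1) / F) ℚ.- (+ 1) / d) ℚ.* fromℕ d ∎)
  where
  open ≡-Reasoning
  F = suc n !
  d = suc (suc n) !
  instance
    _ : ℕ.NonZero F
    _ = suc n !≢0
    _ : ℕ.NonZero d
    _ = suc (suc n) !≢0

-- θ annihilates g ⊛ f = 1.
g⊛θf : ∀ n → (g ⊛ θ f) n ≡ ℚ.- (θ g ⊛ f) n
g⊛θf n = begin
    y
  ≡⟨ solve 2 (λ x y → y := (:- x) :+ (x :+ y)) refl x y ⟩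
    ℚ.- x ℚ.+ (x ℚ.+ y)
  ≡⟨ cong (ℚ.- x ℚ.+_) (sym (θ-⊛ g f n)) ⟩
    ℚ.- x ℚ.+ θ (g ⊛ f) n
  ≡⟨ cong (λ z → ℚ.- x ℚ.+ fromℕ n ℚ.* z) (g⊛f≗1 n) ⟩
    ℚ.- x ℚ.+ θ onePS n
  ≡⟨ cong (ℚ.- x ℚ.+_) (θ-onePS n) ⟩
    ℚ.- x ℚ.+ 0ℚ
  ≡⟨ ℚP.+-identityʳ (ℚ.- x) ⟩
    ℚ.- x ∎
  where
  open ≡-Reasoning
  x = (θ g ⊛ f) n
  y = (g ⊛ θ f) n

θg⊛f : ∀ n → (θ g ⊛ f) n ≡ (f n ℚ.+ (t* onePS) n) ℚ.- onePS n
θg⊛f n = begin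
    (θ g ⊛ f) n
  ≡⟨ ⊛-comm (θ g) f n ⟩
    (f ⊛ θ g) n
  ≡⟨ ⊛-congʳ f {θ g} {(onePS ⊕ (t* g)) ⊕ (⊝ g)} θg n ⟩
    (f ⊛ ((onePS ⊕ (t* g)) ⊕ (⊝ g))) n
  ≡⟨ ⊛-distribˡ-⊕-⊝ f onePS (t* g) g n ⟩
    ((f ⊛ onePS) n ℚ.+ (f ⊛ (t* g)) n) ℚ.- (f ⊛ g) n
  ≡⟨ cong₂ ℚ._-_ (cong₂ ℚ._+_ (⊛-identityʳ f n) (trans (t*-⊛ʳ f g n) (t*-cong f⊛g≗1 n))) (f⊛g≗1 n) ⟩
    (f n ℚ.+ (t* onePS) n) ℚ.- onePS n ∎
  where open ≡-Reasoning

θf : ∀ n → θ f n ≡ (f n ℚ.- (t* f) n) ℚ.- (f ⊛ f) n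
θf n = begin
    θ f n
  ≡⟨ sym (⊛-identityˡ (θ f) n) ⟩
    (onePS ⊛ θ f) n
  ≡⟨ sym (⊛-cong {f ⊛ g} {onePS} {θ f} {θ f} f⊛g≗1 (λ _ → refl) n) ⟩
    ((f ⊛ g) ⊛ θ f) n
  ≡⟨ ⊛-assoc f g (θ f) n ⟩
    (f ⊛ (g ⊛ θ f)) n
  ≡⟨ ⊛-congʳ f {g ⊛ θ f} {⊝ (θ g ⊛ f)} g⊛θf n ⟩
    (f ⊛ (⊝ (θ g ⊛ f))) n
  ≡⟨ ⊛-negʳ f (θ g ⊛ f) n ⟩
    ℚ.- (f ⊛ (θ g ⊛ f)) n
  ≡⟨ cong ℚ.-_ (⊛-congʳ f {θ g ⊛ f} {(f ⊕ (t* onePS)) ⊕ (⊝ onePS)} θg⊛f n) ⟩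
    ℚ.- (f ⊛ ((f ⊕ (t* onePS)) ⊕ (⊝ onePS))) n
  ≡⟨ cong ℚ.-_ (⊛-distribˡ-⊕-⊝ f f (t* onePS) onePS n) ⟩
    ℚ.- (((f ⊛ f) n ℚ.+ (f ⊛ (t* onePS)) n) ℚ.- (f ⊛ onePS) n)
  ≡⟨ cong₂ (λ u v → ℚ.- (((f ⊛ f) n ℚ.+ u) ℚ.- v)) (trans (t*-⊛ʳ f onePS n) (t*-cong (⊛-identityʳ f) n)) (⊛-identityʳ f n) ⟩
    ℚ.- (((f ⊛ f) n ℚ.+ (t* f) n) ℚ.- f n)
  ≡⟨ solve 3 (λ a b c → :- ((a :+ b) :- c) := (c :- b) :- a) refl ((f ⊛ f) n) ((t* f) n) (f n) ⟩
    (f n ℚ.- (t* f) n) ℚ.- (f ⊛ f) n ∎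
  where open ≡-Reasoning

θf^ : ∀ α n → θ (f ^PS α) n ≡ fromℕ α ℚ.* (((f ^PS α) n ℚ.- (t* (f ^PS α)) n) ℚ.- (f ^PS suc α) n)
θf^ zero n = trans (θ-onePS n) (sym (ℚP.*-zeroˡ ((onePS n ℚ.- (t* onePS) n) ℚ.- (f ^PS 1) n)))
θf^ (suc α) n = begin
    θ Q n
  ≡⟨ θ-⊛ f P n ⟩
    (θ f ⊛ P) n ℚ.+ (f ⊛ θ P) n
  ≡⟨ cong₂ ℚ._+_ θf⊛P f⊛θP ⟩
    E ℚ.+ fromℕ α ℚ.* E
  ≡⟨ solve 2 (λ x a → x :+ a :* x := (con 1ℚ :+ a) :* x) refl E (fromℕ α) ⟩
    (1ℚ ℚ.+ fromℕ α) ℚ.* E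
  ≡⟨ cong (ℚ._* E) (sym (fromℕ-suc α)) ⟩
    fromℕ (suc α) ℚ.* E ∎
  where
  open ≡-Reasoning
  P = f ^PS α
  Q = f ⊛ P
  R = f ⊛ Q
  E = (Q n ℚ.- (t* Q) n) ℚ.- R n
  θf⊛P : (θ f ⊛ P) n ≡ E
  θf⊛P = begin
      (θ f ⊛ P) n
    ≡⟨ ⊛-comm (θ f) P n ⟩
      (P ⊛ θ f) n
    ≡⟨ ⊛-congʳ P {θ f} {(f ⊕ (⊝ (t* f))) ⊕ (⊝ (f ⊛ f))} θf n ⟩
      (P ⊛ ((f ⊕ (⊝ (t* f))) ⊕ (⊝ (f ⊛ f)))) n
    ≡⟨ ⊛-distribˡ-⊝-⊝ P f (t* f) (f ⊛ f) n ⟩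
      ((P ⊛ f) n ℚ.- (P ⊛ (t* f)) n) ℚ.- (P ⊛ (f ⊛ f)) n
    ≡⟨ cong₂ ℚ._-_ (cong₂ ℚ._-_ (⊛-comm P f n) (trans (t*-⊛ʳ P f n) (t*-cong (⊛-comm P f) n))) (trans (⊛-comm P (f ⊛ f) n) (⊛-assoc f f P n)) ⟩
      E ∎
  f⊛θP : (f ⊛ θ P) n ≡ fromℕ α ℚ.* E
  f⊛θP = begin
      (f ⊛ θ P) n
    ≡⟨ ⊛-congʳ f {θ P} {scale (fromℕ α) ((P ⊕ (⊝ (t* P))) ⊕ (⊝ Q))} (θf^ α) n ⟩
      (f ⊛ scale (fromℕ α) ((P ⊕ (⊝ (t* P))) ⊕ (⊝ Q))) n
    ≡⟨ ⊛-scaleʳ f ((P ⊕ (⊝ (t* P))) ⊕ (⊝ Q)) (fromℕ α) n ⟩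
      fromℕ α ℚ.* (f ⊛ ((P ⊕ (⊝ (t* P))) ⊕ (⊝ Q))) n
    ≡⟨ cong (fromℕ α ℚ.*_) (⊛-distribˡ-⊝-⊝ f P (t* P) Q n) ⟩
      fromℕ α ℚ.* ((Q n ℚ.- (f ⊛ (t* P)) n) ℚ.- R n)
    ≡⟨ cong (λ z → fromℕ α ℚ.* ((Q n ℚ.- z) ℚ.- R n)) (t*-⊛ʳ f P n) ⟩
      fromℕ α ℚ.* E ∎

-- Coefficients of f^(n+1) and the case m = 1

neg1^² : ∀ j → neg1^ j ℚ.* neg1^ j ≡ 1ℚ
neg1^² zero = refl
neg1^² (suc j) = trans (solve 1 (λ e → (:- e) :* (:- e) := e :* e) refl (neg1^ j)) (neg1^² j)

neg1^-+ : ∀ a b → neg1^ (a ℕ.+ b) ≡ neg1^ a ℚ.* neg1^ b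
neg1^-+ zero b = sym (ℚP.*-identityˡ (neg1^ b))
neg1^-+ (suc a) b = trans (cong ℚ.-_ (neg1^-+ a b)) (ℚP.neg-distribˡ-* (neg1^ a) (neg1^ b))

fromℕ-!-suc : ∀ n x → fromℕ (suc n !) ℚ.* x ≡ fromℕ (n !) ℚ.* (fromℕ (suc n) ℚ.* x)
fromℕ-!-suc n x = trans (cong (ℚ._* x) (fromℕ-* (suc n) (n !))) (solve 3 (λ a F x → (a :* F) :* x := F :* (a :* x)) refl (fromℕ (suc n)) (fromℕ (n !)) x)

cycles-diag-suc : ∀ n → cycles (suc n) (suc n) ≡ cycles n n
cycles-diag-suc n = trans (cong (cycles n n ℕ.+_) (trans (cong (n ℕ.*_) (cycles-< (ℕP.n<1+n n))) (ℕP.*-zeroʳ n))) (ℕP.+-identityʳ _)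

-- Read off coefficientwise, θ(f^(n+1)) = (n+1)(f^(n+1) - t f^(n+1) - f^(n+2)) solved for f^(n+2).
f^-recurrence : ∀ n j → fromℕ (suc n) ℚ.* (f ^PS suc (suc n)) j ≡
  (fromℕ (suc n) ℚ.* (f ^PS suc n) j ℚ.- fromℕ (suc n) ℚ.* (t* (f ^PS suc n)) j) ℚ.- fromℕ j ℚ.* (f ^PS suc n) j
f^-recurrence n j = begin
    a ℚ.* Q j
  ≡⟨ solve 4 (λ a p t q → a :* q := (a :* p :- a :* t) :- a :* ((p :- t) :- q)) refl a (P j) ((t* P) j) (Q j) ⟩
    (a ℚ.* P j ℚ.- a ℚ.* (t* P) j) ℚ.- a ℚ.* ((P j ℚ.- (t* P) j) ℚ.- Q j)
  ≡⟨ cong (λ z → (a ℚ.* P j ℚ.- a ℚ.* (t* P) j) ℚ.- z) (sym (θf^ (suc n) j)) ⟩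
    (a ℚ.* P j ℚ.- a ℚ.* (t* P) j) ℚ.- fromℕ j ℚ.* P j ∎
  where
  open ≡-Reasoning
  a = fromℕ (suc n)
  P = f ^PS suc n
  Q = f ^PS suc (suc n)

CoeffFormula : ℕ → ℕ → ℕ → Set
CoeffFormula n i j = fromℕ (n !) ℚ.* (f ^PS suc n) j ≡ (neg1^ j ℚ.* fromℕ (cycles (suc n) (suc i))) ℚ.* fromℕ (i !)

coeffFormula-diag : ∀ n → CoeffFormula n n 0 → CoeffFormula (suc n) (suc n) 0
coeffFormula-diag n ih = begin
    fromℕ (suc n !) ℚ.* Q 0
  ≡⟨ fromℕ-!-suc n (Q 0) ⟩
    fromℕ (n !) ℚ.* (fromℕ (suc n) ℚ.* Q 0)
  ≡⟨ cong (fromℕ (n !) ℚ.*_) (f^-recurrence n 0) ⟩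
    fromℕ (n !) ℚ.* ((fromℕ (suc n) ℚ.* P 0 ℚ.- fromℕ (suc n) ℚ.* 0ℚ) ℚ.- 0ℚ ℚ.* P 0)
  ≡⟨ solve 3 (λ F a x → F :* ((a :* x :- a :* con 0ℚ) :- con 0ℚ :* x) := a :* (F :* x)) refl (fromℕ (n !)) (fromℕ (suc n)) (P 0) ⟩
    fromℕ (suc n) ℚ.* (fromℕ (n !) ℚ.* P 0)
  ≡⟨ cong (fromℕ (suc n) ℚ.*_) ih ⟩
    fromℕ (suc n) ℚ.* ((1ℚ ℚ.* fromℕ c) ℚ.* fromℕ (n !))
  ≡⟨ solve 3 (λ a u F → a :* ((con 1ℚ :* u) :* F) := (con 1ℚ :* u) :* (a :* F)) refl (fromℕ (suc n)) (fromℕ c) (fromℕ (n !)) ⟩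
    (1ℚ ℚ.* fromℕ c) ℚ.* (fromℕ (suc n) ℚ.* fromℕ (n !))
  ≡⟨ cong₂ (λ u v → (1ℚ ℚ.* fromℕ u) ℚ.* v) (sym (cycles-diag-suc (suc n))) (sym (fromℕ-* (suc n) (n !))) ⟩
    (1ℚ ℚ.* fromℕ (cycles (suc (suc n)) (suc (suc n)))) ℚ.* fromℕ (suc n !) ∎
  where
  open ≡-Reasoning
  P = f ^PS suc n
  Q = f ^PS suc (suc n)
  c = cycles (suc n) (suc n)

-- The case i = 0 holds because c(n+1, 0) = 0.
coeffFormula-scaled : ∀ n i j → (∀ i′ → suc i′ ℕ.+ j ≡ n → CoeffFormula n i′ (suc j)) → i ℕ.+ j ≡ n →
  fromℕ i ℚ.* (fromℕ (n !) ℚ.* (f ^PS suc n) (suc j)) ≡ (neg1^ (suc j) ℚ.* fromℕ (cycles (suc n) i)) ℚ.* fromℕ (i !)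
coeffFormula-scaled n zero j ih _ = begin
    0ℚ ℚ.* (fromℕ (n !) ℚ.* (f ^PS suc n) (suc j))
  ≡⟨ ℚP.*-zeroˡ (fromℕ (n !) ℚ.* (f ^PS suc n) (suc j)) ⟩
    0ℚ
  ≡⟨ sym (trans (cong (λ u → (neg1^ (suc j) ℚ.* fromℕ u) ℚ.* 1ℚ) (cycles-suc-zero n)) (trans (ℚP.*-identityʳ _) (ℚP.*-zeroʳ (neg1^ (suc j))))) ⟩
    (neg1^ (suc j) ℚ.* fromℕ (cycles (suc n) 0)) ℚ.* 1ℚ ∎
  where open ≡-Reasoning
coeffFormula-scaled n (suc i′) j ih i+j≡n = begin
    fromℕ (suc i′) ℚ.* (fromℕ (n !) ℚ.* (f ^PS suc n) (suc j))
  ≡⟨ cong (fromℕ (suc i′) ℚ.*_) (ih i′ i+j≡n) ⟩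
    fromℕ (suc i′) ℚ.* (s ℚ.* fromℕ (i′ !))
  ≡⟨ solve 3 (λ a b F → a :* (b :* F) := b :* (a :* F)) refl (fromℕ (suc i′)) s (fromℕ (i′ !)) ⟩
    s ℚ.* (fromℕ (suc i′) ℚ.* fromℕ (i′ !))
  ≡⟨ cong (s ℚ.*_) (sym (fromℕ-* (suc i′) (i′ !))) ⟩
    s ℚ.* fromℕ (suc i′ !) ∎
  where
  open ≡-Reasoning
  s = neg1^ (suc j) ℚ.* fromℕ (cycles (suc n) (suc i′))

-- The recurrence for the coefficients becomes c(n+2, i+1) = c(n+1, i) + (n+1) c(n+1, i+1).
coeffFormula-step : ∀ n i j → i ℕ.+ j ≡ n → CoeffFormula n i j →
  fromℕ i ℚ.* (fromℕ (n !) ℚ.* (f ^PS suc n) (suc j)) ≡ (neg1^ (suc j) ℚ.* fromℕ (cycles (suc n) i)) ℚ.* fromℕ (i !) →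
  CoeffFormula (suc n) i (suc j)
coeffFormula-step n i j i+j≡n ih scaled = begin
    fromℕ (suc n !) ℚ.* Q (suc j)
  ≡⟨ fromℕ-!-suc n (Q (suc j)) ⟩
    F ℚ.* (a ℚ.* Q (suc j))
  ≡⟨ cong (F ℚ.*_) (f^-recurrence n (suc j)) ⟩
    F ℚ.* ((a ℚ.* P (suc j) ℚ.- a ℚ.* P j) ℚ.- fromℕ (suc j) ℚ.* P (suc j))
  ≡⟨ cong (λ x → F ℚ.* ((x ℚ.* P (suc j) ℚ.- x ℚ.* P j) ℚ.- fromℕ (suc j) ℚ.* P (suc j))) a≡i+[j+1] ⟩
    F ℚ.* (((fromℕ i ℚ.+ fromℕ (suc j)) ℚ.* P (suc j) ℚ.- (fromℕ i ℚ.+ fromℕ (suc j)) ℚ.* P j) ℚ.- fromℕ (suc j) ℚ.* P (suc j))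
  ≡⟨ solve 5 (λ F I S x y → F :* (((I :+ S) :* x :- (I :+ S) :* y) :- S :* x) := I :* (F :* x) :- (I :+ S) :* (F :* y)) refl F (fromℕ i) (fromℕ (suc j)) (P (suc j)) (P j) ⟩
    fromℕ i ℚ.* (F ℚ.* P (suc j)) ℚ.- (fromℕ i ℚ.+ fromℕ (suc j)) ℚ.* (F ℚ.* P j)
  ≡⟨ cong₂ (λ u v → u ℚ.- v ℚ.* (F ℚ.* P j)) scaled (sym a≡i+[j+1]) ⟩
    (neg1^ (suc j) ℚ.* fromℕ c₀) ℚ.* fromℕ (i !) ℚ.- a ℚ.* (F ℚ.* P j)
  ≡⟨ cong (λ z → (neg1^ (suc j) ℚ.* fromℕ c₀) ℚ.* fromℕ (i !) ℚ.- a ℚ.* z) ih ⟩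
    (neg1^ (suc j) ℚ.* fromℕ c₀) ℚ.* fromℕ (i !) ℚ.- a ℚ.* ((neg1^ j ℚ.* fromℕ c₁) ℚ.* fromℕ (i !))
  ≡⟨ solve 5 (λ e u₀ u₁ a F → ((:- e) :* u₀) :* F :- a :* ((e :* u₁) :* F) := ((:- e) :* (u₀ :+ a :* u₁)) :* F) refl (neg1^ j) (fromℕ c₀) (fromℕ c₁) a (fromℕ (i !)) ⟩
    (neg1^ (suc j) ℚ.* (fromℕ c₀ ℚ.+ a ℚ.* fromℕ c₁)) ℚ.* fromℕ (i !)
  ≡⟨ cong (λ z → (neg1^ (suc j) ℚ.* z) ℚ.* fromℕ (i !)) (sym (trans (fromℕ-+ c₀ _) (cong (fromℕ c₀ ℚ.+_) (fromℕ-* (suc n) c₁)))) ⟩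
    (neg1^ (suc j) ℚ.* fromℕ (cycles (suc (suc n)) (suc i))) ℚ.* fromℕ (i !) ∎
  where
  open ≡-Reasoning
  F = fromℕ (n !)
  a = fromℕ (suc n)
  P = f ^PS suc n
  Q = f ^PS suc (suc n)
  c₀ = cycles (suc n) i
  c₁ = cycles (suc n) (suc i)
  a≡i+[j+1] : a ≡ fromℕ i ℚ.+ fromℕ (suc j)
  a≡i+[j+1] = trans (cong fromℕ (sym (trans (ℕP.+-suc i j) (cong suc i+j≡n)))) (fromℕ-+ i (suc j))

coeffFormula : ∀ n i j → i ℕ.+ j ≡ n → CoeffFormula n i j
coeffFormula zero zero zero refl = refl
coeffFormula (suc n) i zero i+0≡1+n = subst (λ x → CoeffFormula (suc n) x 0) (sym (trans (sym (ℕP.+-identityʳ i)) i+0≡1+n))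
  (coeffFormula-diag n (coeffFormula n n 0 (ℕP.+-identityʳ n)))
coeffFormula (suc n) i (suc j) i+1+j≡1+n = coeffFormula-step n i j i+j≡n (coeffFormula n i j i+j≡n)
  (coeffFormula-scaled n i j (λ i′ e → coeffFormula n i′ (suc j) (trans (ℕP.+-suc i′ j) e)) i+j≡n)
  where
  i+j≡n : i ℕ.+ j ≡ n
  i+j≡n = ℕP.suc-injective (trans (sym (ℕP.+-suc i j)) i+1+j≡1+n)

multichoose : ℕ → ℕ → ℚ
multichoose k l = (+ ((k ℕ.+ l ∸ 1) !)) / (l ! ℕ.* (k ∸ 1) !)
  where instance _ = l !* (k ∸ 1) !≢0

weight : ℕ → ℕ → ℚ
weight k l = (neg1^ l ℚ.* multichoose k l) ℚ.* B (k ℕ.+ l) l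

-- The case m = 1 of the theorem.
weight≡cycles : ∀ k′ l → weight (suc k′) l ≡ fromℕ (cycles (suc k′ ℕ.+ l) (suc k′))
weight≡cycles k′ l = *-cancelʳ-fromℕ (l ! ℕ.* k′ !) (begin
    ((E ℚ.* m) ℚ.* (L ℚ.* c)) ℚ.* D
  ≡⟨ solve 5 (λ E m L c D → ((E :* m) :* (L :* c)) :* D := (E :* L) :* ((m :* D) :* c)) refl E m L c D ⟩
    (E ℚ.* L) ℚ.* ((m ℚ.* D) ℚ.* c)
  ≡⟨ cong (λ z → (E ℚ.* L) ℚ.* (z ℚ.* c)) (/-*-cancel ((k′ ℕ.+ l) !) (l ! ℕ.* k′ !)) ⟩
    (E ℚ.* L) ℚ.* (fromℕ ((k′ ℕ.+ l) !) ℚ.* c)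
  ≡⟨ cong ((E ℚ.* L) ℚ.*_) (coeffFormula (k′ ℕ.+ l) k′ l refl) ⟩
    (E ℚ.* L) ℚ.* ((E ℚ.* u) ℚ.* K)
  ≡⟨ solve 4 (λ E L u K → (E :* L) :* ((E :* u) :* K) := (E :* E) :* (u :* (L :* K))) refl E L u K ⟩
    (E ℚ.* E) ℚ.* (u ℚ.* (L ℚ.* K))
  ≡⟨ cong₂ (λ a b → a ℚ.* (u ℚ.* b)) (neg1^² l) (sym (fromℕ-* (l !) (k′ !))) ⟩
    1ℚ ℚ.* (u ℚ.* D)
  ≡⟨ ℚP.*-identityˡ (u ℚ.* D) ⟩
    u ℚ.* D ∎)
  where
  open ≡-Reasoning
  instance _ = l !* k′ !≢0
  E = neg1^ l
  m = multichoose (suc k′) l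
  L = fromℕ (l !)
  c = (f ^PS suc (k′ ℕ.+ l)) l
  D = fromℕ (l ! ℕ.* k′ !)
  K = fromℕ (k′ !)
  u = fromℕ (cycles (suc k′ ℕ.+ l) (suc k′))

-- Peeling the right-hand side

summand : ℕ → ℕ → List ℕ → ℚ
summand n k ks = neg1^ (sumℕ ks) ℚ.* multinomial n ks k ℚ.* prodB n ks

sumCompositions : ℕ → ℕ → (List ℕ → ℚ) → ℚ
sumCompositions zero t H = iverson (0 ℕ.≟ t) (H [])
sumCompositions (suc m) t H = Σ (suc t) (λ l → sumCompositions m (t ∸ l) (λ v → H (l ∷ v)))

sumCompositions-cong : ∀ m t {H G : List ℕ → ℚ} → (∀ v → sumℕ v ≡ t → H v ≡ G v) → sumCompositions m t H ≡ sumCompositions m t G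
sumCompositions-cong zero t H≡G with 0 ℕ.≟ t
... | yes 0≡t = H≡G [] 0≡t
... | no _ = refl
sumCompositions-cong (suc m) t H≡G = Σ-cong< (suc t) (λ l l<1+t →
  sumCompositions-cong m (t ∸ l) (λ v e → H≡G (l ∷ v) (trans (cong (l ℕ.+_) e) (ℕP.m+[n∸m]≡n (ℕP.≤-pred l<1+t)))))

sumCompositions-distribʳ : ∀ m t (H : List ℕ → ℚ) c → sumCompositions m t (λ v → H v ℚ.* c) ≡ sumCompositions m t H ℚ.* c
sumCompositions-distribʳ zero t H c with 0 ℕ.≟ t
... | yes _ = refl
... | no _ = sym (ℚP.*-zeroˡ c)
sumCompositions-distribʳ (suc m) t H c = trans
  (Σ-cong (suc t) (λ l → sumCompositions-distribʳ m (t ∸ l) (λ v → H (l ∷ v)) c))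
  (Σ-distribʳ (suc t) c (λ l → sumCompositions m (t ∸ l) (λ v → H (l ∷ v))))

iverson-+≟ : ∀ l x t (q : ℚ) → l ≤ t → iverson ((l ℕ.+ x) ℕ.≟ t) q ≡ iverson (x ℕ.≟ (t ∸ l)) q
iverson-+≟ l x t q l≤t with (l ℕ.+ x) ℕ.≟ t | x ℕ.≟ (t ∸ l)
... | yes _ | yes _ = refl
... | no _ | no _ = refl
... | yes l+x≡t | no x≢t∸l = ⊥-elim (x≢t∸l (trans (sym (ℕP.m+n∸m≡n l x)) (cong (_∸ l) l+x≡t)))
... | no l+x≢t | yes x≡t∸l = ⊥-elim (l+x≢t (trans (cong (l ℕ.+_) x≡t∸l) (ℕP.m+[n∸m]≡n l≤t)))

iverson-+≟-< : ∀ l x t (q : ℚ) → t < l → iverson ((l ℕ.+ x) ℕ.≟ t) q ≡ 0ℚ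
iverson-+≟-< l x t q t<l with (l ℕ.+ x) ℕ.≟ t
... | no _ = refl
... | yes l+x≡t = ⊥-elim (ℕP.<-irrefl refl (ℕP.<-≤-trans t<l (subst (l ≤_) l+x≡t (ℕP.m≤m+n l x))))

-- Parts larger than t cannot occur in a composition of t, so the first part ranges over 0, …, t only.
sumMap-tuples≡sumCompositions : ∀ m s t (H : List ℕ → ℚ) → t ≤ s →
  sumMap (λ v → iverson (sumℕ v ℕ.≟ t) (H v)) (tuples m s) ≡ sumCompositions m t H
sumMap-tuples≡sumCompositions zero s t H t≤s = ℚP.+-identityʳ _
sumMap-tuples≡sumCompositions (suc m) s t H t≤s = begin
    sumMap F (concatMap (λ l → map (l ∷_) (tuples m s)) (upTo (suc s)))
  ≡⟨ sumMap-concatMap F (λ l → map (l ∷_) (tuples m s)) (upTo (suc s)) ⟩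
    sumMap (λ l → sumMap F (map (l ∷_) (tuples m s))) (upTo (suc s))
  ≡⟨ sumMap-upTo (λ l → sumMap F (map (l ∷_) (tuples m s))) (suc s) ⟩
    Σ (suc s) (λ l → sumMap F (map (l ∷_) (tuples m s)))
  ≡⟨ Σ-cong (suc s) (λ l → sumMap-map F (l ∷_) (tuples m s)) ⟩
    Σ (suc s) G
  ≡⟨ cong (λ z → Σ z G) (sym (ℕP.m+[n∸m]≡n (s≤s t≤s))) ⟩
    Σ (suc t ℕ.+ (suc s ∸ suc t)) G
  ≡⟨ Σ-split (suc t) (suc s ∸ suc t) G ⟩
    Σ (suc t) G ℚ.+ Σ (suc s ∸ suc t) (λ r → G (suc t ℕ.+ r))
  ≡⟨ cong₂ ℚ._+_ (Σ-cong< (suc t) (λ l l<1+t → G≡ l (ℕP.≤-pred l<1+t))) (Σ-≡0 (suc s ∸ suc t) (λ r _ → G≡0 r)) ⟩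
    sumCompositions (suc m) t H ℚ.+ 0ℚ
  ≡⟨ ℚP.+-identityʳ _ ⟩
    sumCompositions (suc m) t H ∎
  where
  open ≡-Reasoning
  F : List ℕ → ℚ
  F v = iverson (sumℕ v ℕ.≟ t) (H v)
  G : ℕ → ℚ
  G l = sumMap (λ v → F (l ∷ v)) (tuples m s)
  G≡ : ∀ l → l ≤ t → G l ≡ sumCompositions m (t ∸ l) (λ v → H (l ∷ v))
  G≡ l l≤t = trans (sumMap-cong (tuples m s) (λ v → iverson-+≟ l (sumℕ v) t (H (l ∷ v)) l≤t))
    (sumMap-tuples≡sumCompositions m s (t ∸ l) (λ v → H (l ∷ v)) (ℕP.≤-trans (ℕP.m∸n≤m t l) t≤s))
  G≡0 : ∀ r → G (suc t ℕ.+ r) ≡ 0ℚ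
  G≡0 r = sumMap-≡0 (tuples m s) (λ v → iverson-+≟-< (suc t ℕ.+ r) (sumℕ v) t (H ((suc t ℕ.+ r) ∷ v)) (s≤s (ℕP.m≤m+n t r)))

RHS≡sumCompositions : ∀ m n k → RHS m n k ≡ sumCompositions m (n ∸ k) (summand n k)
RHS≡sumCompositions m n k = trans (sumMap-filter (λ v → sumℕ v ℕ.≟ (n ∸ k)) (summand n k) (tuples m (n ∸ k)))
  (sumMap-tuples≡sumCompositions m (n ∸ k) (n ∸ k) (summand n k) ℕP.≤-refl)

/-factor : ∀ a b c d e .{{_ : ℕ.NonZero b}} .{{_ : ℕ.NonZero c}} .{{_ : ℕ.NonZero d}} →
  b ℕ.* e ≡ c ℕ.* d → (+ a) / b ≡ ((+ a) / c) ℚ.* ((+ e) / d)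
/-factor a b c d e {{_}} {{c≢0}} {{d≢0}} be≡cd = *-cancelʳ-fromℕ (c ℕ.* d) {{ℕP.m*n≢0 c d {{c≢0}} {{d≢0}}}} (begin
    (+ a) / b ℚ.* fromℕ (c ℕ.* d)
  ≡⟨ cong (λ z → (+ a) / b ℚ.* fromℕ z) (sym be≡cd) ⟩
    (+ a) / b ℚ.* fromℕ (b ℕ.* e)
  ≡⟨ cong ((+ a) / b ℚ.*_) (fromℕ-* b e) ⟩
    (+ a) / b ℚ.* (fromℕ b ℚ.* fromℕ e)
  ≡⟨ sym (ℚP.*-assoc ((+ a) / b) (fromℕ b) (fromℕ e)) ⟩
    ((+ a) / b ℚ.* fromℕ b) ℚ.* fromℕ e
  ≡⟨ cong (ℚ._* fromℕ e) (/-*-cancel a b) ⟩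
    fromℕ a ℚ.* fromℕ e
  ≡⟨ sym (cong₂ ℚ._*_ (/-*-cancel a c) (/-*-cancel e d)) ⟩
    ((+ a) / c ℚ.* fromℕ c) ℚ.* ((+ e) / d ℚ.* fromℕ d)
  ≡⟨ solve 4 (λ x y p q → (x :* p) :* (y :* q) := (x :* y) :* (p :* q)) refl ((+ a) / c) ((+ e) / d) (fromℕ c) (fromℕ d) ⟩
    (((+ a) / c) ℚ.* ((+ e) / d)) ℚ.* (fromℕ c ℚ.* fromℕ d)
  ≡⟨ cong ((((+ a) / c) ℚ.* ((+ e) / d)) ℚ.*_) (sym (fromℕ-* c d)) ⟩
    (((+ a) / c) ℚ.* ((+ e) / d)) ℚ.* fromℕ (c ℕ.* d) ∎)
  where open ≡-Reasoning

product! : List ℕ → ℕ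
product! v = foldr ℕ._*_ 1 (map _! v)

product!≢0 : ∀ v → ℕ.NonZero (product! v)
product!≢0 [] = _
product!≢0 (x ∷ xs) = ℕP.m*n≢0 (x !) _ {{x !≢0}} {{product!≢0 xs}}

multinomial-∷ : ∀ n k′ l v → multinomial n (l ∷ v) (suc k′) ≡ multinomial n v (suc k′ ℕ.+ l) ℚ.* multichoose (suc k′) l
multinomial-∷ n k′ l v = /-factor ((n ∸ 1) !) ((l ! ℕ.* P) ℕ.* k′ !) (P ℕ.* (k′ ℕ.+ l) !) (l ! ℕ.* k′ !) ((k′ ℕ.+ l) !)
  (ℕ-solve 4 (λ L p K E → ((L ℕ-:* p) ℕ-:* K) ℕ-:* E ℕ-:= (p ℕ-:* E) ℕ-:* (L ℕ-:* K)) refl (l !) P (k′ !) ((k′ ℕ.+ l) !))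
  where
  open ℕSolver.+-*-Solver using () renaming (solve to ℕ-solve; _:*_ to _ℕ-:*_; _:=_ to _ℕ-:=_)
  P = product! v
  instance
    _ = ℕP.m*n≢0 (l ! ℕ.* P) (k′ !) {{ℕP.m*n≢0 (l !) P {{l !≢0}} {{product!≢0 v}}}} {{k′ !≢0}}
    _ = ℕP.m*n≢0 P ((k′ ℕ.+ l) !) {{product!≢0 v}} {{(k′ ℕ.+ l) !≢0}}
    _ = l !* k′ !≢0

n∸sum≡k+l : ∀ n k l s → k ≤ n → l ≤ n ∸ k → s ≡ n ∸ k ∸ l → n ∸ s ≡ k ℕ.+ l
n∸sum≡k+l n k l s k≤n l≤n∸k s≡ = begin
    n ∸ s
  ≡⟨ cong (_∸ s) (sym (ℕP.m+[n∸m]≡n k≤n)) ⟩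
    (k ℕ.+ (n ∸ k)) ∸ s
  ≡⟨ cong (λ z → (k ℕ.+ z) ∸ s) (sym (trans (cong (ℕ._+ l) s≡) (ℕP.m∸n+n≡m l≤n∸k))) ⟩
    (k ℕ.+ (s ℕ.+ l)) ∸ s
  ≡⟨ cong (_∸ s) (trans (cong (k ℕ.+_) (ℕP.+-comm s l)) (sym (ℕP.+-assoc k l s))) ⟩
    (k ℕ.+ l ℕ.+ s) ∸ s
  ≡⟨ ℕP.m+n∸n≡m (k ℕ.+ l) s ⟩
    k ℕ.+ l ∎
  where open ≡-Reasoning

-- The first part l of (l, v) contributes the factor B^(n - sum v)_l = B^(k+l)_l.
summand-∷ : ∀ n k′ l v → suc k′ ≤ n → l ≤ n ∸ suc k′ → sumℕ v ≡ n ∸ suc k′ ∸ l →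
  summand n (suc k′) (l ∷ v) ≡ summand n (suc k′ ℕ.+ l) v ℚ.* weight (suc k′) l
summand-∷ n k′ l v k≤n l≤n∸k sum≡ = begin
    neg1^ (l ℕ.+ s) ℚ.* multinomial n (l ∷ v) k ℚ.* (B (n ∸ s) l ℚ.* prodB n v)
  ≡⟨ cong₂ (λ x y → x ℚ.* multinomial n (l ∷ v) k ℚ.* (B y l ℚ.* prodB n v)) (neg1^-+ l s) (n∸sum≡k+l n k l s k≤n l≤n∸k sum≡) ⟩
    (El ℚ.* Ev) ℚ.* multinomial n (l ∷ v) k ℚ.* (Bl ℚ.* Pv)
  ≡⟨ cong (λ z → (El ℚ.* Ev) ℚ.* z ℚ.* (Bl ℚ.* Pv)) (multinomial-∷ n k′ l v) ⟩
    (El ℚ.* Ev) ℚ.* (Mv ℚ.* M) ℚ.* (Bl ℚ.* Pv)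
  ≡⟨ solve 6 (λ El Ev Mv M Bl Pv → (El :* Ev) :* (Mv :* M) :* (Bl :* Pv) := ((Ev :* Mv) :* Pv) :* ((El :* M) :* Bl)) refl El Ev Mv M Bl Pv ⟩
    ((Ev ℚ.* Mv) ℚ.* Pv) ℚ.* ((El ℚ.* M) ℚ.* Bl) ∎
  where
  open ≡-Reasoning
  k = suc k′
  s = sumℕ v
  El = neg1^ l
  Ev = neg1^ s
  Mv = multinomial n v (k ℕ.+ l)
  M = multichoose k l
  Bl = B (k ℕ.+ l) l
  Pv = prodB n v

RHS-suc : ∀ m n k′ → suc k′ ≤ n →
  RHS (suc m) n (suc k′) ≡ Σ (suc (n ∸ suc k′)) (λ l → RHS m n (suc k′ ℕ.+ l) ℚ.* weight (suc k′) l)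
RHS-suc m n k′ k≤n = trans (RHS≡sumCompositions (suc m) n k) (Σ-cong< (suc t) λ l l<1+t → begin
    sumCompositions m (t ∸ l) (λ v → summand n k (l ∷ v))
  ≡⟨ sumCompositions-cong m (t ∸ l) (λ v sum≡ → summand-∷ n k′ l v k≤n (ℕP.≤-pred l<1+t) sum≡) ⟩
    sumCompositions m (t ∸ l) (λ v → summand n (k ℕ.+ l) v ℚ.* weight k l)
  ≡⟨ sumCompositions-distribʳ m (t ∸ l) (summand n (k ℕ.+ l)) (weight k l) ⟩
    sumCompositions m (t ∸ l) (summand n (k ℕ.+ l)) ℚ.* weight k l
  ≡⟨ cong (λ z → sumCompositions m z (summand n (k ℕ.+ l)) ℚ.* weight k l) (ℕP.∸-+-assoc n k l) ⟩
    sumCompositions m (n ∸ (k ℕ.+ l)) (summand n (k ℕ.+ l)) ℚ.* weight k l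
  ≡⟨ cong (ℚ._* weight k l) (sym (RHS≡sumCompositions m n (k ℕ.+ l))) ⟩
    RHS m n (k ℕ.+ l) ℚ.* weight k l ∎)
  where
  open ≡-Reasoning
  k = suc k′
  t = n ∸ k

Σ-iverson-last : ∀ t (G : ℕ → ℚ) → Σ (suc t) (λ l → iverson (0 ℕ.≟ (t ∸ l)) (G l)) ≡ G t
Σ-iverson-last zero G = trans (Σ-suc 0 _) (trans (cong (G 0 ℚ.+_) (Σ-zero _)) (ℚP.+-identityʳ (G 0)))
Σ-iverson-last (suc t) G = trans (Σ-suc (suc t) _) (trans (ℚP.+-identityˡ _) (Σ-iverson-last t (λ l → G (suc l))))

multinomial-[] : ∀ n → multinomial n [] n ≡ 1ℚ
multinomial-[] n = *-cancelʳ-fromℕ D (begin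
    multinomial n [] n ℚ.* fromℕ D
  ≡⟨ /-*-cancel ((n ∸ 1) !) D ⟩
    fromℕ ((n ∸ 1) !)
  ≡⟨ cong fromℕ (sym (ℕP.*-identityˡ ((n ∸ 1) !))) ⟩
    fromℕ D
  ≡⟨ sym (ℚP.*-identityˡ (fromℕ D)) ⟩
    1ℚ ℚ.* fromℕ D ∎)
  where
  open ≡-Reasoning
  D = 1 ℕ.* (n ∸ 1) !
  instance _ = ℕP.m*n≢0 1 ((n ∸ 1) !) {{_}} {{(n ∸ 1) !≢0}}

RHS-one : ∀ n k′ → suc k′ ≤ n → RHS 1 n (suc k′) ≡ fromℕ (cycles n (suc k′))
RHS-one n k′ k≤n = begin
    RHS 1 n k
  ≡⟨ RHS≡sumCompositions 1 n k ⟩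
    Σ (suc t) (λ l → iverson (0 ℕ.≟ (t ∸ l)) (summand n k (l ∷ [])))
  ≡⟨ Σ-iverson-last t (λ l → summand n k (l ∷ [])) ⟩
    summand n k (t ∷ [])
  ≡⟨ summand-∷ n k′ t [] k≤n ℕP.≤-refl (sym (ℕP.n∸n≡0 t)) ⟩
    summand n (k ℕ.+ t) [] ℚ.* weight k t
  ≡⟨ cong₂ ℚ._*_ (cong (λ z → summand n z []) k+t≡n) (weight≡cycles k′ t) ⟩
    summand n n [] ℚ.* fromℕ (cycles (k ℕ.+ t) k)
  ≡⟨ cong₂ ℚ._*_ (trans (ℚP.*-identityʳ _) (trans (ℚP.*-identityˡ _) (multinomial-[] n))) (cong (λ z → fromℕ (cycles z k)) k+t≡n) ⟩
    1ℚ ℚ.* fromℕ (cycles n k)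
  ≡⟨ ℚP.*-identityˡ _ ⟩
    fromℕ (cycles n k) ∎
  where
  open ≡-Reasoning
  k = suc k′
  t = n ∸ k
  k+t≡n : k ℕ.+ t ≡ n
  k+t≡n = ℕP.m+[n∸m]≡n k≤n

-- Matrix powers

Matrix : Set
Matrix = ℕ → ℕ → ℚ

-- The product of the (N+1) × (N+1) corners, indices 0, …, N.
matMul : ℕ → Matrix → Matrix → Matrix
matMul N A C x y = Σ (suc N) (λ j → A x j ℚ.* C j y)

matMul-assoc : ∀ N (A C E : Matrix) x y → matMul N (matMul N A C) E x y ≡ matMul N A (matMul N C E) x y
matMul-assoc N A C E x y = begin
    Σ (suc N) (λ j → Σ (suc N) (λ i → A x i ℚ.* C i j) ℚ.* E j y)
  ≡⟨ Σ-cong (suc N) (λ j → sym (Σ-distribʳ (suc N) (E j y) (λ i → A x i ℚ.* C i j))) ⟩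
    Σ (suc N) (λ j → Σ (suc N) (λ i → (A x i ℚ.* C i j) ℚ.* E j y))
  ≡⟨ Σ-swap (suc N) (suc N) (λ j i → (A x i ℚ.* C i j) ℚ.* E j y) ⟩
    Σ (suc N) (λ i → Σ (suc N) (λ j → (A x i ℚ.* C i j) ℚ.* E j y))
  ≡⟨ Σ-cong (suc N) (λ i → trans (Σ-cong (suc N) (λ j → ℚP.*-assoc (A x i) (C i j) (E j y))) (Σ-distribˡ (suc N) (A x i) (λ j → C i j ℚ.* E j y))) ⟩
    Σ (suc N) (λ i → A x i ℚ.* Σ (suc N) (λ j → C i j ℚ.* E j y)) ∎
  where open ≡-Reasoning

matMul-cong : ∀ N {A A′ C C′ : Matrix} → (∀ x y → A x y ≡ A′ x y) → (∀ x y → C x y ≡ C′ x y) →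
  ∀ x y → matMul N A C x y ≡ matMul N A′ C′ x y
matMul-cong N A≡A′ C≡C′ x y = Σ-cong (suc N) (λ j → cong₂ ℚ._*_ (A≡A′ x j) (C≡C′ j y))

-- Both compute A^(p+1).
powˡ : ℕ → Matrix → ℕ → Matrix
powˡ N A zero = A
powˡ N A (suc p) = matMul N A (powˡ N A p)

powʳ : ℕ → Matrix → ℕ → Matrix
powʳ N A zero = A
powʳ N A (suc p) = matMul N (powʳ N A p) A

powʳ-comm : ∀ N A p x y → matMul N A (powʳ N A p) x y ≡ matMul N (powʳ N A p) A x y
powʳ-comm N A zero x y = refl
powʳ-comm N A (suc p) x y = trans (sym (matMul-assoc N A (powʳ N A p) A x y))
  (matMul-cong N {C = A} {C′ = A} (powʳ-comm N A p) (λ _ _ → refl) x y)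

powˡ≡powʳ : ∀ N A p x y → powˡ N A p x y ≡ powʳ N A p x y
powˡ≡powʳ N A zero x y = refl
powˡ≡powʳ N A (suc p) x y = trans (matMul-cong N {A} (λ _ _ → refl) (powˡ≡powʳ N A p) x y) (powʳ-comm N A p x y)

cyclesMatrix : Matrix
cyclesMatrix x y = fromℕ (cycles x y)

LHS-sum≡powˡ : ∀ N r x y → fromℕ (sumℕ (map (λ ls → ℤ.∣ chain x ls y ∣) (tuples r N))) ≡ powˡ N cyclesMatrix r x y
LHS-sum≡powˡ N zero x y = cong fromℕ (trans (ℕP.+-identityʳ _) (∣S1∣≡cycles x y))
LHS-sum≡powˡ N (suc r) x y = begin
    fromℕ (sumℕ (map F (concatMap (λ l → map (l ∷_) (tuples r N)) (upTo (suc N)))))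
  ≡⟨ fromℕ-sumℕ F (concatMap (λ l → map (l ∷_) (tuples r N)) (upTo (suc N))) ⟩
    sumMap F′ (concatMap (λ l → map (l ∷_) (tuples r N)) (upTo (suc N)))
  ≡⟨ sumMap-concatMap F′ (λ l → map (l ∷_) (tuples r N)) (upTo (suc N)) ⟩
    sumMap (λ l → sumMap F′ (map (l ∷_) (tuples r N))) (upTo (suc N))
  ≡⟨ sumMap-upTo (λ l → sumMap F′ (map (l ∷_) (tuples r N))) (suc N) ⟩
    Σ (suc N) (λ l → sumMap F′ (map (l ∷_) (tuples r N)))
  ≡⟨ Σ-cong (suc N) first-step ⟩
    powˡ N cyclesMatrix (suc r) x y ∎
  where
  open ≡-Reasoning
  F : List ℕ → ℕ
  F ls = ℤ.∣ chain x ls y ∣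
  F′ : List ℕ → ℚ
  F′ ls = fromℕ (F ls)
  first-step : ∀ l → sumMap F′ (map (l ∷_) (tuples r N)) ≡ cyclesMatrix x l ℚ.* powˡ N cyclesMatrix r l y
  first-step l = begin
      sumMap F′ (map (l ∷_) (tuples r N))
    ≡⟨ sumMap-map F′ (l ∷_) (tuples r N) ⟩
      sumMap (λ ls → fromℕ ℤ.∣ S1 x l ℤ.* chain l ls y ∣) (tuples r N)
    ≡⟨ sumMap-cong (tuples r N) (λ ls → trans (cong fromℕ (trans (ℤP.abs-* (S1 x l) (chain l ls y)) (cong (ℕ._* ℤ.∣ chain l ls y ∣) (∣S1∣≡cycles x l)))) (fromℕ-* (cycles x l) _)) ⟩
      sumMap (λ ls → cyclesMatrix x l ℚ.* fromℕ ℤ.∣ chain l ls y ∣) (tuples r N)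
    ≡⟨ sumMap-distribˡ (cyclesMatrix x l) (λ ls → fromℕ ℤ.∣ chain l ls y ∣) (tuples r N) ⟩
      cyclesMatrix x l ℚ.* sumMap (λ ls → fromℕ ℤ.∣ chain l ls y ∣) (tuples r N)
    ≡⟨ cong (cyclesMatrix x l ℚ.*_) (trans (sym (fromℕ-sumℕ (λ ls → ℤ.∣ chain l ls y ∣) (tuples r N))) (LHS-sum≡powˡ N r l y)) ⟩
      cyclesMatrix x l ℚ.* powˡ N cyclesMatrix r l y ∎

-- cycles is lower triangular, so the sum over j ≤ n of the matrix product only sees j ≥ k.
RHS≡powʳ : ∀ p n k′ → suc k′ ≤ n → RHS (suc p) n (suc k′) ≡ powʳ n cyclesMatrix p n (suc k′)
RHS≡powʳ zero n k′ k≤n = RHS-one n k′ k≤n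
RHS≡powʳ (suc p) n k′ k≤n = begin
    RHS (suc (suc p)) n k
  ≡⟨ RHS-suc (suc p) n k′ k≤n ⟩
    Σ (suc t) (λ l → RHS (suc p) n (k ℕ.+ l) ℚ.* weight k l)
  ≡⟨ Σ-cong< (suc t) (λ l l<1+t → cong₂ ℚ._*_ (RHS≡powʳ p n (k′ ℕ.+ l) (k+l≤n l (ℕP.≤-pred l<1+t))) (weight≡cycles k′ l)) ⟩
    Σ (suc t) (λ l → G (k ℕ.+ l))
  ≡⟨ sym (ℚP.+-identityˡ _) ⟩
    0ℚ ℚ.+ Σ (suc t) (λ l → G (k ℕ.+ l))
  ≡⟨ cong (ℚ._+ Σ (suc t) (λ l → G (k ℕ.+ l))) (sym (Σ-≡0 k (λ j j<k → trans (cong (λ u → powʳ n cyclesMatrix p n j ℚ.* fromℕ u) (cycles-< j<k)) (ℚP.*-zeroʳ (powʳ n cyclesMatrix p n j))))) ⟩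
    Σ k G ℚ.+ Σ (suc t) (λ l → G (k ℕ.+ l))
  ≡⟨ sym (Σ-split k (suc t) G) ⟩
    Σ (k ℕ.+ suc t) G
  ≡⟨ cong (λ z → Σ z G) (trans (ℕP.+-suc k t) (cong suc (ℕP.m+[n∸m]≡n k≤n))) ⟩
    Σ (suc n) G ∎
  where
  open ≡-Reasoning
  k = suc k′
  t = n ∸ k
  G : ℕ → ℚ
  G j = powʳ n cyclesMatrix p n j ℚ.* cyclesMatrix j k
  k+l≤n : ∀ l → l ≤ t → k ℕ.+ l ≤ n
  k+l≤n l l≤t = ℕP.≤-trans (ℕP.+-monoʳ-≤ k l≤t) (ℕP.≤-reflexive (ℕP.m+[n∸m]≡n k≤n))

theorem1 : (m n k : ℕ) → 1 ≤ m → 1 ≤ n → 1 ≤ k → k ≤ n →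
    (+ LHS m n k) / 1 ≡ RHS m n k
theorem1 (suc p) n (suc k′) _ _ _ k≤n = begin
    fromℕ (LHS (suc p) n k)
  ≡⟨ LHS-sum≡powˡ n p n k ⟩
    powˡ n cyclesMatrix p n k
  ≡⟨ powˡ≡powʳ n cyclesMatrix p n k ⟩
    powʳ n cyclesMatrix p n k
  ≡⟨ sym (RHS≡powʳ p n k′ k≤n) ⟩
    RHS (suc p) n k ∎
  where
  open ≡-Reasoning
  k = suc k′
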